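{- The Hopf algebras $\mathcal K^\vee(\mathbf{PF})$ and $\mathrm{PQSym}$ are isomorphic.
   Context: Work over a field $\Bbbk$ of characteristic $0$. A weak set composition of a finite set $I$ is a list $(A_1,\dots,A_k)$ of pairwise disjoint possibly empty subsets with union $I$, of length $k$ and size $\sum|A_i|$. For $|I|=n$, a parking function on $I$ is a weak set composition $(A_1,\dots,A_n)$ of $I$ with $\sum_{i\le k}|A_i|\ge k$ for $1\le k\le n$. $\mathsf{park}$ of a weak set composition $(B_1,\dots,B_k)$: start with $\Phi=()$; for $i=1,\dots,k$, append $B_i$ to $\Phi$ if (size of $\Phi$)$+|B_i|\ge$(length of $\Phi$)$+1$, else discard it. $\mathbf{PF}$ is the linearized species of parking functions, a Hopf monoid in species (Cauchy product) with product $\Phi\otimes\Psi\mapsto\Phi|\Psi$ (concatenation) and coproduct $\Delta_{S,T}(\Phi)=\mathsf{park}(\Phi_{\cap S})\otimes\mathsf{park}(\Phi_{\cap T})$, $\Phi_{\cap S}=(A_1\cap S,\dots,A_n\cap S)$. For a Hopf monoid $\mathbf h$ in species, $\mathcal K^\vee(\mathbf h)=\bigoplus_{n\ge0}\mathbf h[n]$ ($[n]=\{1,\dots,n\}$) with product, for $x\in\mathbf h[s]$, $y\in\mathbf h[t]$, $x\cdot y=\sum\mu_{S,T}(\mathbf h[\mathrm{cano}_S](x)\otimes\mathbf h[\mathrm{cano}_T](y))$ summed over $S\sqcup T=[s+t]$ with $|S|=s$, where $\mathrm{cano}_S:[s]\to S$, $\mathrm{cano}_T:[t]\to T$ are the order-preserving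 bijections; and coproduct $\Delta(x)=\sum_{i=0}^n(\mathbf h[\mathrm{st}]\otimes\mathbf h[\mathrm{st}])\Delta_{[i],[i+1,n]}(x)$ for $x\in\mathbf h[n]$, $\mathrm{st}$ the order-preserving bijections onto $[i]$, $[n-i]$. $\mathrm{PQSym}$ (Novelli–Thibon) has basis $F_a$ indexed by parking words $a=a_1\cdots a_n$ (words in positive integers whose nondecreasing rearrangement $b$ satisfies $b_i\le i$), graded by length, with product $F_aF_b=\sum_{c\in a\,\sqcup\!\sqcup\, b[n]}F_c$ ($n$ the length of $a$, $b[n]$ obtained by adding $n$ to each letter of $b$, $\sqcup\!\sqcup$ the shuffle), and coproduct $\Delta F_a=\sum_{u\cdot v=a}F_{\mathrm{Park}(u)}\otimes F_{\mathrm{Park}(v)}$ over deconcatenations, where for a word $u$ of length $k$, $\mathrm{Park}(u)=u$ if $u$ is a parking word, and otherwise $\mathrm{Park}(u)=\mathrm{Park}(u')$ with $u'$ obtained by decrementing all letters greater than $d(u)=\min\{i:\#\{j:u_j\le i\}<i\}$. -}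

module Defs where

open import Level using (Level; _⊔_) renaming (suc to lsuc)
open import Data.Nat using (ℕ; zero; suc; _+_; _∸_; _≤ᵇ_; _<ᵇ_; _≡ᵇ_)
open import Data.Nat.Properties using () renaming (_≟_ to _≟ℕ_)
open import Data.Bool using (Bool; true; false; _∧_; _∨_; not; if_then_else_; T)
open import Data.Bool.Properties using (T?)
open import Data.List using (List; []; _∷_; _++_; map; concat; concatMap; length; foldr; upTo; filterᵇ; take; drop; null)
open import Data.Bool.ListAction using (any; all)
open import Data.Nat.ListAction using (sum)
open import Data.List.Properties using (≡-dec)
open import Data.Product using (Σ; _×_; _,_; proj₁; proj₂)
open import Data.Product.Properties as ×P using ()
open import Data.Unit using (tt)
open import Relation.Binary.PropositionalEquality using (_≡_; refl; cong)
open import Relation.Binary.Definitions using (DecidableEquality)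
open import Relation.Nullary using (¬_; yes; no; Dec; does)
open import Algebra.Bundles using (CommutativeRing)

record Field (c ℓ : Level) : Set (lsuc (c ⊔ ℓ)) where
  field
    commutativeRing : CommutativeRing c ℓ
  open CommutativeRing commutativeRing public
  field
    1#≉0#   : ¬ (1# ≈ 0#)
    inverse : ∀ x → ¬ (x ≈ 0#) → Σ Carrier λ y → x * y ≈ 1#

ι : ∀ {c ℓ} (K : Field c ℓ) → ℕ → Field.Carrier K
ι K zero    = Field.0# K
ι K (suc n) = Field._+_ K (Field.1# K) (ι K n)

CharZero : ∀ {c ℓ} (K : Field c ℓ) → Set ℓ
CharZero K = ∀ n → ¬ (Field._≈_ K (ι K (suc n)) (Field.0# K))

-- Basis types carved out of raw data by a decidable (Boolean) predicate

T-irr : ∀ {b} (p q : T b) → p ≡ q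
T-irr {true} tt tt = refl

Carve : {R : Set} → (R → Bool) → Set
Carve {R} P = Σ R (λ r → T (P r))

carve-≟ : {R : Set} → DecidableEquality R → (P : R → Bool) → DecidableEquality (Carve P)
carve-≟ _≟_ P (r , p) (s , q) with r ≟ s
... | no r≢s = no (λ e → r≢s (cong proj₁ e))
carve-≟ _≟_ P (r , p) (.r , q) | yes refl with T-irr p q
... | refl = yes refl

-- Free vector spaces: finite formal linear combinations of basis elements

module FreeModule {c ℓ} (K : Field c ℓ) where
  open Field K using (Carrier; _≈_; 0#; 1#) renaming (_+_ to _+K_; _*_ to _*K_)

  Lin : Set → Set c
  Lin B = List (Carrier × B)

  coeff : {B : Set} → DecidableEquality B → Lin B → B → Carrier
  coeff _≟_ [] b = 0#
  coeff _≟_ ((x , b′) ∷ v) b with does (b′ ≟ b)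
  ... | true  = x +K coeff _≟_ v b
  ... | false = coeff _≟_ v b

  Eq : {B : Set} → DecidableEquality B → Lin B → Lin B → Set ℓ
  Eq _≟_ v w = ∀ b → coeff _≟_ v b ≈ coeff _≟_ w b

  scale : {B : Set} → Carrier → Lin B → Lin B
  scale x = map (λ p → x *K proj₁ p , proj₂ p)

  extend : {A B : Set} → (A → Lin B) → Lin A → Lin B
  extend f = concatMap (λ p → scale (proj₁ p) (f (proj₂ p)))

  extend₂ : {A A′ B : Set} → (A → A′ → Lin B) → Lin A → Lin A′ → Lin B
  extend₂ f v w = concatMap (λ p → concatMap (λ q → scale (proj₁ p *K proj₁ q) (f (proj₂ p) (proj₂ q))) w) v

  tensor : {A B : Set} → Lin A → Lin B → Lin (A × B)
  tensor = extend₂ (λ a b → (1# , (a , b)) ∷ [])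

  extend⊗ : {A A′ B B′ : Set} → (A → Lin B) → (A′ → Lin B′) → Lin (A × A′) → Lin (B × B′)
  extend⊗ f g = extend (λ p → tensor (f (proj₁ p)) (g (proj₂ p)))

  evalL : {A : Set} → (A → Carrier) → Lin A → Carrier
  evalL f = foldr (λ p r → proj₁ p *K f (proj₂ p) +K r) 0#

  embed : {R : Set} (P : R → Bool) → R → Lin (Carve P)
  embed P r with T? (P r)
  ... | yes p = (1# , (r , p)) ∷ []
  ... | no _  = []

  -- a bialgebra over K given by a basis and structure constants
  record BasedBialgebra : Set (lsuc Level.zero ⊔ c) where
    field
      Basis   : Set
      _≟B_    : DecidableEquality Basis
      unitB   : Basis
      mulB    : Basis → Basis → Lin Basis
      comulB  : Basis → Lin (Basis × Basis)
      counitB : Basis → Carrier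

    _≈V_ : Lin Basis → Lin Basis → Set ℓ
    _≈V_ = Eq _≟B_

    _≈V⊗_ : Lin (Basis × Basis) → Lin (Basis × Basis) → Set ℓ
    _≈V⊗_ = Eq (×P.≡-dec _≟B_ _≟B_)

    mul : Lin Basis → Lin Basis → Lin Basis
    mul = extend₂ mulB

    comul : Lin Basis → Lin (Basis × Basis)
    comul = extend comulB

    counit : Lin Basis → Carrier
    counit = evalL counitB

    one : Lin Basis
    one = (1# , unitB) ∷ []

  -- an isomorphism of bialgebras (equivalently, of Hopf algebras:
  -- a bialgebra isomorphism between Hopf algebras commutes with the antipodes)
  record BialgebraIso (H H′ : BasedBialgebra) : Set (c ⊔ ℓ) where
    private
      module H  = BasedBialgebra H
      module H′ = BasedBialgebra H′
    field
      φ : H.Basis → Lin H′.Basis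
      ψ : H′.Basis → Lin H.Basis
    Φ : Lin H.Basis → Lin H′.Basis
    Φ = extend φ
    Ψ : Lin H′.Basis → Lin H.Basis
    Ψ = extend ψ
    field
      ΨΦ        : ∀ v → H._≈V_ (Ψ (Φ v)) v
      ΦΨ        : ∀ w → H′._≈V_ (Φ (Ψ w)) w
      Φ-unit    : H′._≈V_ (Φ H.one) H′.one
      Φ-mul     : ∀ v w → H′._≈V_ (Φ (H.mul v w)) (H′.mul (Φ v) (Φ w))
      Φ-comul   : ∀ v → H′._≈V⊗_ (extend⊗ φ φ (H.comul v)) (H′.comul (Φ v))
      Φ-counit  : ∀ v → H′.counit (Φ v) ≈ H.counit v

insertℕ : ℕ → List ℕ → List ℕ
insertℕ x [] = x ∷ []
insertℕ x (y ∷ ys) = if x ≤ᵇ y then x ∷ y ∷ ys else y ∷ insertℕ x ys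

sortℕ : List ℕ → List ℕ
sortℕ = foldr insertℕ []

eqListℕ : List ℕ → List ℕ → Bool
eqListℕ u v = does (≡-dec _≟ℕ_ u v)

elemℕ : ℕ → List ℕ → Bool
elemℕ x = any (λ y → x ≡ᵇ y)

interval : ℕ → List ℕ
interval n = map suc (upTo n)

-- i-th entry (1-indexed), 0 if out of range
nth : List ℕ → ℕ → ℕ
nth [] i = 0
nth (x ∷ xs) zero = 0
nth (x ∷ xs) (suc zero) = x
nth (x ∷ xs) (suc (suc i)) = nth xs (suc i)

choose : ℕ → List ℕ → List (List ℕ)
choose zero xs = [] ∷ []
choose (suc k) [] = []
choose (suc k) (x ∷ xs) = map (x ∷_) (choose k xs) ++ choose (suc k) xs

boundedFrom : ℕ → List ℕ → Bool
boundedFrom i [] = true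
boundedFrom i (b ∷ bs) = (b ≤ᵇ i) ∧ boundedFrom (suc i) bs

isParkingWord : List ℕ → Bool
isParkingWord u = all (λ x → 1 ≤ᵇ x) u ∧ boundedFrom 1 (sortℕ u)

count≤ : ℕ → List ℕ → ℕ
count≤ i u = length (filterᵇ (λ x → x ≤ᵇ i) u)

searchD : ℕ → ℕ → List ℕ → ℕ
searchD zero i u = i
searchD (suc f) i u = if count≤ i u <ᵇ i then i else searchD f (suc i) u

-- d(u) = min { i ≥ 1 : #{j : u_j ≤ i} < i }  (it is ≤ length u + 1)
dPark : List ℕ → ℕ
dPark u = searchD (suc (length u)) 1 u

parkStep : List ℕ → List ℕ
parkStep u = map (λ x → if dPark u <ᵇ x then x ∸ 1 else x) u

-- Park, iterated with fuel; each non-trivial step on a word in positive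
-- integers lowers the sum of the letters, so fuel = 1 + sum u suffices
parkWordF : ℕ → List ℕ → List ℕ
parkWordF zero u = u
parkWordF (suc f) u = if isParkingWord u then u else parkWordF f (parkStep u)

Park : List ℕ → List ℕ
Park u = parkWordF (suc (sum u)) u

shuffle : List ℕ → List ℕ → List (List ℕ)
shuffle [] v = v ∷ []
shuffle (x ∷ u) [] = (x ∷ u) ∷ []
shuffle (x ∷ u) (y ∷ v) = map (x ∷_) (shuffle u (y ∷ v)) ++ map (y ∷_) (shuffle (x ∷ u) v)

deconcatenations : List ℕ → List (List ℕ × List ℕ)
deconcatenations a = map (λ i → take i a , drop i a) (upTo (suc (length a)))

ParkingWord : Set
ParkingWord = Carve isParkingWord

-- Parking functions as weak set compositions (A_1,...,A_n) of [n]
-- A block (a finite subset of ℕ) is represented canonically by the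
-- strictly increasing list of its elements.

strictlyIncreasing : List ℕ → Bool
strictlyIncreasing [] = true
strictlyIncreasing (x ∷ []) = true
strictlyIncreasing (x ∷ y ∷ ys) = (x <ᵇ y) ∧ strictlyIncreasing (y ∷ ys)

-- blocks are sets, pairwise disjoint, with union [n]
isWeakSetCompositionOf : ℕ → List (List ℕ) → Bool
isWeakSetCompositionOf n Φ = all strictlyIncreasing Φ ∧ eqListℕ (sortℕ (concat Φ)) (interval n)

-- Σ_{i ≤ k} |A_i| ≥ k for all k (k counts blocks seen, s their total size)
prefixCondition : ℕ → ℕ → List (List ℕ) → Bool
prefixCondition k s [] = true
prefixCondition k s (A ∷ Φ) = (suc k ≤ᵇ s + length A) ∧ prefixCondition (suc k) (s + length A) Φ

isParkingFunction : List (List ℕ) → Bool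
isParkingFunction Φ = isWeakSetCompositionOf (length Φ) Φ ∧ prefixCondition 0 0 Φ

ParkingFunction : Set
ParkingFunction = Carve isParkingFunction

-- park, with Φ so far of size s and length l
parkC : ℕ → ℕ → List (List ℕ) → List (List ℕ)
parkC s l [] = []
parkC s l (B ∷ Bs) = if suc l ≤ᵇ s + length B then B ∷ parkC (s + length B) (suc l) Bs else parkC s l Bs

park : List (List ℕ) → List (List ℕ)
park = parkC 0 0

restrictLow : ℕ → List (List ℕ) → List (List ℕ)
restrictLow i = map (filterᵇ (λ x → x ≤ᵇ i))

restrictHigh : ℕ → List (List ℕ) → List (List ℕ)
restrictHigh i = map (filterᵇ (λ x → i <ᵇ x))

-- PF[st] for [i+1,n] → [n-i]
shiftDown : ℕ → List (List ℕ) → List (List ℕ)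
shiftDown i = map (map (λ x → x ∸ i))

-- PF[cano_S] for cano_S : [s] → S order preserving (S increasing list)
relabel : List ℕ → List (List ℕ) → List (List ℕ)
relabel S = map (map (nth S))

complementIn : ℕ → List ℕ → List ℕ
complementIn m S = filterᵇ (λ x → not (elemℕ x S)) (interval m)

module _ {c ℓ} (K : Field c ℓ) where
  open Field K using (0#; 1#)
  open FreeModule K

  private
    embedPair : {R : Set} (P : R → Bool) → R → R → Lin (Carve P × Carve P)
    embedPair P r s = tensor (embed P r) (embed P s)

  PQSym : BasedBialgebra
  PQSym = record
    { Basis   = ParkingWord
    ; _≟B_    = carve-≟ (≡-dec _≟ℕ_) isParkingWord
    ; unitB   = [] , tt
    ; mulB    = λ a b → concatMap (embed isParkingWord)
                          (shuffle (proj₁ a) (map (λ x → length (proj₁ a) + x) (proj₁ b)))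
    ; comulB  = λ a → concatMap (λ uv → embedPair isParkingWord (Park (proj₁ uv)) (Park (proj₂ uv)))
                          (deconcatenations (proj₁ a))
    ; counitB = λ a → if null (proj₁ a) then 1# else 0#
    }

  KdualPF : BasedBialgebra
  KdualPF = record
    { Basis   = ParkingFunction
    ; _≟B_    = carve-≟ (≡-dec (≡-dec _≟ℕ_)) isParkingFunction
    ; unitB   = [] , tt
    ; mulB    = λ x y →
        let s = length (proj₁ x) ; t = length (proj₁ y) in
        concatMap (λ S → embed isParkingFunction
                           (relabel S (proj₁ x) ++ relabel (complementIn (s + t) S) (proj₁ y)))
                  (choose s (interval (s + t)))
    ; comulB  = λ x →
        let n = length (proj₁ x) in
        concatMap (λ i → embedPair isParkingFunction
                           (park (restrictLow i (proj₁ x)))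
                           (shiftDown i (park (restrictHigh i (proj₁ x)))))
                  (upTo (suc n))
    ; counitB = λ x → if null (proj₁ x) then 1# else 0#
    }

module Submission where

-- A parking function Φ = (A_1, …, A_n) on [n] corresponds to the parking word a with a_j = v for
-- j ∈ A_v. Since Σ_{v ≤ i} |A_v| = #{j : a_j ≤ i}, the prefix condition on Φ is the parking condition
-- on a, so Φ ↦ F_a is a bijection of bases. In a product of K^∨(PF), choosing the positions S of the
-- first factor is choosing a shuffle pattern, and relabelling along cano_S and cano_T yields the
-- parking function of the corresponding shuffle of a with b[s]. Restricting Φ to [i] and [i+1, n]
-- gives the blocks of the prefix and the suffix of a, and on such blocks park and Park agree: one
-- Park step, lowering the letters above d(u), deletes exactly the empty block d that park discards.
-- Finally, a bijection of bases preserving all structure constants is a bialgebra isomorphism.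

open import Level using (_⊔_)
open import Function using (_∘_)
open import Function.Bundles using (Equivalence)
open import Data.Empty using (⊥; ⊥-elim)
open import Data.Unit using (tt)
open import Data.Bool using (Bool; true; false; T; if_then_else_; _∧_; _∨_; not)
open import Data.Bool.Properties using (T-∧)
open import Data.Bool.ListAction using (all)
open import Data.Nat hiding (_⊔_)
open import Data.Nat.Properties
open import Data.Nat.ListAction using (sum)
open import Algebra.Properties.CommutativeSemigroup +-commutativeSemigroup using (interchange; x∙yz≈y∙xz)
open import Data.Product using (_×_; _,_; proj₁; proj₂; map₁; map₂) renaming (map to map×)
open import Data.Product.Relation.Binary.Pointwise.NonDependent using (×-setoid)
open import Data.List
  using (List; []; _∷_; _++_; map; length; filterᵇ; concat; concatMap; take; drop; replicate; applyUpTo; upTo)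
open import Data.List.Properties
  using (≡-dec; length-map; length-++; length-filter; filter-++; filter-none; filter-all; map-id-local; map-++;
         map-∘; map-cong; map-cong-local; map-upTo; ++-identityʳ; take++drop≡id; concatMap-map; concatMap-cong;
         map-concatMap)
open import Data.List.Relation.Unary.All as All using (All; []; _∷_)
open import Data.List.Relation.Unary.All.Properties as All using (all⁺; all⁻; concat⁻)
open import Data.List.Relation.Unary.Linked as Linked using (_∷_)
open import Data.List.Relation.Unary.Linked.Properties using (Linked⇒All)
open import Data.List.Relation.Unary.Sorted.TotalOrder ≤-totalOrder using (Sorted)
open import Data.List.Relation.Unary.Sorted.TotalOrder.Properties using (↗↭↗⇒≋)
import Data.List.Sort.InsertionSort.Base ≤-decTotalOrder as InsertionSort
import Data.List.Sort.InsertionSort.Properties ≤-decTotalOrder as InsertionSortProperties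
open import Data.List.Relation.Binary.Permutation.Propositional
  using (_↭_; prep; ↭-sym; ↭-trans; ↭-reflexive; ↭⇒↭ₛ)
open import Data.List.Relation.Binary.Permutation.Propositional.Properties
  using (↭-length; filter-↭; All-resp-↭; shift; ++⁺ˡ; ++-comm)
open import Data.List.Relation.Binary.Pointwise as Pointwise using (Pointwise-≡⇒≡; []; _∷_)
open import Relation.Binary.Bundles using (Setoid)
open import Relation.Binary.Definitions using (DecidableEquality; tri<; tri≈; tri>)
open import Relation.Binary.PropositionalEquality
import Relation.Binary.Reasoning.Setoid as SetoidReasoning
open import Relation.Nullary using (¬_; yes; no; does)
open import Relation.Nullary.Decidable using (dec-true; dec-false; T?)
open import Relation.Nullary.Negation using (contradiction)

open import Defs

private
  variable
    A B : Set
    xs ys : List ℕ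

≡true⇒T : ∀ {b} → b ≡ true → T b
≡true⇒T refl = tt

∧-elim : ∀ {a b} → T (a ∧ b) → T a × T b
∧-elim = Equivalence.to T-∧

∧-intro : ∀ {a b} → T a → T b → T (a ∧ b)
∧-intro p q = Equivalence.from T-∧ (p , q)

-- `does (m ≤? n)` computes to `m ≤ᵇ n`, and likewise for `_<?_` and `_≟_`.
≤ᵇ-true : ∀ {m n} → m ≤ n → (m ≤ᵇ n) ≡ true
≤ᵇ-true {m} {n} = dec-true (m ≤? n)

≤ᵇ-false : ∀ {m n} → n < m → (m ≤ᵇ n) ≡ false
≤ᵇ-false {m} {n} n<m = dec-false (m ≤? n) (<⇒≱ n<m)

<ᵇ-true : ∀ {m n} → m < n → (m <ᵇ n) ≡ true
<ᵇ-true {m} {n} = dec-true (m <? n)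

<ᵇ-false : ∀ {m n} → n ≤ m → (m <ᵇ n) ≡ false
<ᵇ-false {m} {n} n≤m = dec-false (m <? n) (≤⇒≯ n≤m)

≡ᵇ-refl : ∀ n → (n ≡ᵇ n) ≡ true
≡ᵇ-refl n = dec-true (n ≟ n) refl

≡ᵇ-false : ∀ {m n} → m ≢ n → (m ≡ᵇ n) ≡ false
≡ᵇ-false {m} {n} = dec-false (m ≟ n)

≤ᵇ-cong-⇔ : ∀ {m n m′ n′} → (m ≤ n → m′ ≤ n′) → (m′ ≤ n′ → m ≤ n) → (m ≤ᵇ n) ≡ (m′ ≤ᵇ n′)
≤ᵇ-cong-⇔ {m} {n} to from with m ≤? n
... | yes m≤n = trans (≤ᵇ-true m≤n) (sym (≤ᵇ-true (to m≤n)))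
... | no  m≰n = trans (≤ᵇ-false (≰⇒> m≰n)) (sym (≤ᵇ-false (≰⇒> (m≰n ∘ from))))

≡ᵇ-+ : ∀ s x w → (s + x ≡ᵇ s + w) ≡ (x ≡ᵇ w)
≡ᵇ-+ zero    x w = refl
≡ᵇ-+ (suc s) x w = ≡ᵇ-+ s x w

indicator : Bool → ℕ
indicator true  = 1
indicator false = 0

count : (A → Bool) → List A → ℕ
count p xs = length (filterᵇ p xs)

count-∷ : ∀ (p : A → Bool) x xs → count p (x ∷ xs) ≡ indicator (p x) + count p xs
count-∷ p x xs with p x
... | true  = refl
... | false = refl

count-++ : ∀ (p : A → Bool) xs ys → count p (xs ++ ys) ≡ count p xs + count p ys
count-++ p xs ys = trans (cong length (filter-++ (T? ∘ p) xs ys)) (length-++ (filterᵇ p xs))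

count-≤-length : ∀ (p : A → Bool) xs → count p xs ≤ length xs
count-≤-length p = length-filter (T? ∘ p)

count-↭ : ∀ (p : A → Bool) {xs ys} → xs ↭ ys → count p xs ≡ count p ys
count-↭ p = ↭-length ∘ filter-↭ (T? ∘ p)

count-none : ∀ (p : A → Bool) {xs} → All (λ x → p x ≡ false) xs → count p xs ≡ 0
count-none p []                = refl
count-none p (px≡false ∷ rest) rewrite px≡false = count-none p rest

count-all : ∀ (p : A → Bool) {xs} → All (λ x → p x ≡ true) xs → count p xs ≡ length xs
count-all p []               = refl
count-all p (px≡true ∷ rest) rewrite px≡true = cong suc (count-all p rest)

count≡0⇒none : ∀ (p : A → Bool) xs → count p xs ≡ 0 → All (λ x → p x ≡ false) xs
count≡0⇒none p []       _ = []
count≡0⇒none p (x ∷ xs) c with p x in px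
... | false = px ∷ count≡0⇒none p xs c

count-full⇒all : ∀ (p : A → Bool) xs → length xs ≤ count p xs → All (λ x → p x ≡ true) xs
count-full⇒all p []       _ = []
count-full⇒all p (x ∷ xs) c with p x in px
... | true  = px ∷ count-full⇒all p xs (s≤s⁻¹ c)
... | false = ⊥-elim (<⇒≱ (s≤s (count-≤-length p xs)) c)

filterᵇ-cong-local : ∀ (p q : A → Bool) {xs} → All (λ x → p x ≡ q x) xs → filterᵇ p xs ≡ filterᵇ q xs
filterᵇ-cong-local p q []                  = refl
filterᵇ-cong-local p q {x ∷ _} (same ∷ rest) rewrite same with q x
... | true  = cong (x ∷_) (filterᵇ-cong-local p q rest)
... | false = filterᵇ-cong-local p q rest

concatMap-cong-local : ∀ {a b} {A : Set a} {B : Set b} {f g : A → List B} {xs} →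
                       All (λ x → f x ≡ g x) xs → concatMap f xs ≡ concatMap g xs
concatMap-cong-local f≗g = cong concat (map-cong-local f≗g)

filterᵇ-none : ∀ (p : A → Bool) {xs} → All (λ x → p x ≡ false) xs → filterᵇ p xs ≡ []
filterᵇ-none p none = filter-none (T? ∘ p) (All.map (λ px≡false → subst T px≡false) none)

count-map : ∀ (p : B → Bool) (q : A → Bool) (g : A → B) {xs} →
            All (λ x → p (g x) ≡ q x) xs → count p (map g xs) ≡ count q xs
count-map p q g []                     = refl
count-map p q g {x ∷ xs} (e ∷ rest) =
  trans (count-∷ p (g x) (map g xs))
        (trans (cong₂ _+_ (cong indicator e) (count-map p q g rest)) (sym (count-∷ q x xs)))

range : ℕ → ℕ → List ℕ
range k zero    = []
range k (suc n) = k ∷ range (suc k) n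

length-range : ∀ k n → length (range k n) ≡ n
length-range k zero    = refl
length-range k (suc n) = cong suc (length-range (suc k) n)

range-bounds : ∀ k n → All (λ j → k ≤ j × j < k + n) (range k n)
range-bounds k zero    = []
range-bounds k (suc n) =
  (≤-refl , m<m+n k z<s)
  ∷ All.map (λ {j} (k<j , j<) → <⇒≤ k<j , subst (j <_) (sym (+-suc k n)) j<) (range-bounds (suc k) n)

out-of-empty-range : ∀ {k j} → k ≤ j → j < k + 0 → ⊥
out-of-empty-range {k} k≤j j<k+0 = <⇒≱ j<k+0 (subst (_≤ _) (sym (+-identityʳ k)) k≤j)

<-+-suc : ∀ {j k n} → j < k + suc n → j < suc k + n
<-+-suc {j} {k} {n} = subst (j <_) (+-suc k n)

range-++ : ∀ k s t → range k s ++ range (k + s) t ≡ range k (s + t)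
range-++ k zero    t rewrite +-identityʳ k = refl
range-++ k (suc s) t rewrite +-suc k s     = cong (k ∷_) (range-++ (suc k) s t)

map-+-range : ∀ m k n → map (m +_) (range k n) ≡ range (m + k) n
map-+-range m k zero    = refl
map-+-range m k (suc n) rewrite map-+-range m (suc k) n | +-suc m k = refl

applyUpTo≡range : ∀ {f} k n → (∀ i → f i ≡ k + i) → applyUpTo f n ≡ range k n
applyUpTo≡range k zero    f≗k+ = refl
applyUpTo≡range k (suc n) f≗k+ =
  cong₂ _∷_ (trans (f≗k+ 0) (+-identityʳ k))
            (applyUpTo≡range (suc k) n (λ i → trans (f≗k+ (suc i)) (+-suc k i)))

interval≡range : ∀ n → interval n ≡ range 1 n
interval≡range n = trans (map-upTo suc n) (applyUpTo≡range 1 n (λ _ → refl))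

range-sorted : ∀ k n → Sorted (range k n)
range-sorted k zero          = Linked.[]
range-sorted k (suc zero)    = Linked.[-]
range-sorted k (suc (suc n)) = n≤1+n k ∷ range-sorted (suc k) (suc n)

-- Sorting

-- The library's insertion sort branches on `does (x ≤? y)`, which computes to `x ≤ᵇ y`.
sortℕ≡sort : ∀ xs → sortℕ xs ≡ InsertionSort.sort xs
sortℕ≡sort []       = refl
sortℕ≡sort (x ∷ xs) rewrite sortℕ≡sort xs = insertℕ≡insert (InsertionSort.sort xs)
  where
  insertℕ≡insert : ∀ ys → insertℕ x ys ≡ InsertionSort.insert x ys
  insertℕ≡insert []       = refl
  insertℕ≡insert (y ∷ ys) with x ≤ᵇ y
  ... | true  = refl
  ... | false = cong (y ∷_) (insertℕ≡insert ys)

sortℕ-↭ : ∀ xs → sortℕ xs ↭ xs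
sortℕ-↭ xs rewrite sortℕ≡sort xs = InsertionSortProperties.sort-↭ xs

sortℕ-sorted : ∀ xs → Sorted (sortℕ xs)
sortℕ-sorted xs rewrite sortℕ≡sort xs = InsertionSortProperties.sort-↗ xs

sorted-↭⇒≡ : Sorted xs → Sorted ys → xs ↭ ys → xs ≡ ys
sorted-↭⇒≡ xs↗ ys↗ xs↭ys = Pointwise-≡⇒≡ (↗↭↗⇒≋ ≤-totalOrder xs↗ ys↗ (↭⇒↭ₛ xs↭ys))

length-sortℕ : ∀ xs → length (sortℕ xs) ≡ length xs
length-sortℕ xs = ↭-length (sortℕ-↭ xs)

eqListℕ⇒≡ : ∀ u v → T (eqListℕ u v) → u ≡ v
eqListℕ⇒≡ u v t with ≡-dec _≟_ u v
... | yes u≡v = u≡v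

≡⇒eqListℕ : ∀ {u v} → u ≡ v → T (eqListℕ u v)
≡⇒eqListℕ {u} {v} u≡v = ≡true⇒T (dec-true (≡-dec _≟_ u v) u≡v)

-- Parking words

-- The parking condition b_i ≤ i on the sorted word b, in counting form.
HasParkingCounts : List ℕ → Set
HasParkingCounts u = ∀ j → 1 ≤ j → j ≤ length u → j ≤ count≤ j u

count≤-∷-≤ : ∀ {x j} b → x ≤ j → count≤ j (x ∷ b) ≡ suc (count≤ j b)
count≤-∷-≤ b x≤j rewrite ≤ᵇ-true x≤j = refl

boundedFrom⇒count : ∀ k b → T (boundedFrom k b) → ∀ i → i < length b → suc i ≤ count≤ (k + i) b
boundedFrom⇒count k (x ∷ b) t i i<1+∣b∣
  rewrite count≤-∷-≤ b (≤-trans (≤ᵇ⇒≤ x k (proj₁ (∧-elim t))) (m≤m+n k i)) with i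
... | zero  = s≤s z≤n
... | suc i = s≤s (subst (λ j → suc i ≤ count≤ j b) (sym (+-suc k i))
                    (boundedFrom⇒count (suc k) b (proj₂ (∧-elim t)) i (s≤s⁻¹ i<1+∣b∣)))

boundedFrom⇐count : ∀ k b → Sorted b → (∀ i → i < length b → suc i ≤ count≤ (k + i) b) → T (boundedFrom k b)
boundedFrom⇐count k []      _  _     = tt
boundedFrom⇐count k (x ∷ b) b↗ enough with x ≤? k
... | yes x≤k = ∧-intro (≤⇒≤ᵇ x≤k) (boundedFrom⇐count (suc k) b (Linked.tail b↗) enough′)
  where
  enough′ : ∀ i → i < length b → suc i ≤ count≤ (suc k + i) b
  enough′ i i<∣b∣ with enough (suc i) (s≤s i<∣b∣)
  ... | c rewrite count≤-∷-≤ b (≤-trans x≤k (m≤m+n k (suc i))) | +-suc k i = s≤s⁻¹ c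
... | no x≰k =
  ⊥-elim (<⇒≱ (enough 0 z<s) (≤-reflexive (count-none _ (All.map above (Linked⇒All ≤-trans ≤-refl b↗)))))
  where
  above : ∀ {y} → x ≤ y → (y ≤ᵇ k + 0) ≡ false
  above x≤y = ≤ᵇ-false (subst (_< _) (sym (+-identityʳ k)) (<-≤-trans (≰⇒> x≰k) x≤y))

isParkingWord⇒positive : ∀ u → T (isParkingWord u) → All (1 ≤_) u
isParkingWord⇒positive u t = All.map (≤ᵇ⇒≤ 1 _) (all⁺ (1 ≤ᵇ_) u (proj₁ (∧-elim t)))

isParkingWord⇒counts : ∀ u → T (isParkingWord u) → HasParkingCounts u
isParkingWord⇒counts u t (suc i) _ j≤∣u∣ =
  subst (suc i ≤_) (count-↭ _ (sortℕ-↭ u))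
    (boundedFrom⇒count 1 (sortℕ u) (proj₂ (∧-elim t)) i (subst (i <_) (sym (length-sortℕ u)) j≤∣u∣))

isParkingWord-intro : ∀ {u} → All (1 ≤_) u → HasParkingCounts u → T (isParkingWord u)
isParkingWord-intro {u} positive counts =
  ∧-intro (all⁻ (1 ≤ᵇ_) (All.map ≤⇒≤ᵇ positive)) (boundedFrom⇐count 1 (sortℕ u) (sortℕ-sorted u) counts′)
  where
  counts′ : ∀ i → i < length (sortℕ u) → suc i ≤ count≤ (suc i) (sortℕ u)
  counts′ i i< = subst (suc i ≤_) (sym (count-↭ _ (sortℕ-↭ u)))
                   (counts (suc i) (s≤s z≤n) (subst (suc i ≤_) (length-sortℕ u) i<))

-- Words and weak set compositions

positionsFrom : ℕ → ℕ → List ℕ → List ℕ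
positionsFrom k v []      = []
positionsFrom k v (x ∷ u) =
  if x ≡ᵇ v then k ∷ positionsFrom (suc k) v u else positionsFrom (suc k) v u

blocks : List ℕ → List ℕ → List (List ℕ)
blocks u vs = map (λ v → positionsFrom 1 v u) vs

-- A word u of length n and the weak set composition (A_1, …, A_n) with A_v = {j : u_j = v};
-- toWord is the inverse correspondence.
toPF : List ℕ → List (List ℕ)
toPF u = blocks u (range 1 (length u))

blockIndexFrom : ℕ → ℕ → List (List ℕ) → ℕ
blockIndexFrom k j []      = k
blockIndexFrom k j (B ∷ Φ) = if elemℕ j B then k else blockIndexFrom (suc k) j Φ

toWord : List (List ℕ) → List ℕ
toWord Φ = map (λ j → blockIndexFrom 1 j Φ) (range 1 (length Φ))

lookupFrom : A → ℕ → List A → ℕ → A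
lookupFrom d k []      j = d
lookupFrom d k (x ∷ a) j = if j ≡ᵇ k then x else lookupFrom d (suc k) a j

occurrences : ℕ → List ℕ → ℕ
occurrences x vs = count (x ≡ᵇ_) vs

length-toPF : ∀ u → length (toPF u) ≡ length u
length-toPF u = trans (length-map _ (range 1 (length u))) (length-range 1 (length u))

length-toWord : ∀ Φ → length (toWord Φ) ≡ length Φ
length-toWord Φ = trans (length-map _ (range 1 (length Φ))) (length-range 1 (length Φ))

map-lookupFrom-range : ∀ (d : A) k a → map (lookupFrom d k a) (range k (length a)) ≡ a
map-lookupFrom-range d k []      = refl
map-lookupFrom-range d k (x ∷ a) rewrite ≡ᵇ-refl k =
  cong (x ∷_) (trans (map-cong-local (All.map skip (range-bounds (suc k) (length a))))
                     (map-lookupFrom-range d (suc k) a))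
  where
  skip : ∀ {j} → suc k ≤ j × j < suc k + length a → lookupFrom d k (x ∷ a) j ≡ lookupFrom d (suc k) a j
  skip (k<j , _) rewrite ≡ᵇ-false (>⇒≢ k<j) = refl

lookupFrom-All : ∀ {P : A → Set} (d : A) k u j → All P u → k ≤ j → j < k + length u → P (lookupFrom d k u j)
lookupFrom-All d k []      j []         k≤j j< = ⊥-elim (out-of-empty-range k≤j j<)
lookupFrom-All d k (x ∷ u) j (px ∷ pu) k≤j j< with j ≟ k
... | yes refl rewrite ≡ᵇ-refl j = px
... | no j≢k   rewrite ≡ᵇ-false j≢k =
  lookupFrom-All d (suc k) u j pu (≤∧≢⇒< k≤j (j≢k ∘ sym)) (<-+-suc j<)

positionsFrom-≥ : ∀ k v u → All (k ≤_) (positionsFrom k v u)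
positionsFrom-≥ k v []      = []
positionsFrom-≥ k v (x ∷ u) with x ≡ᵇ v
... | true  = ≤-refl ∷ All.map <⇒≤ (positionsFrom-≥ (suc k) v u)
... | false = All.map <⇒≤ (positionsFrom-≥ (suc k) v u)

positionsFrom-increasing : ∀ k v u → T (strictlyIncreasing (positionsFrom k v u))
positionsFrom-increasing k v []      = tt
positionsFrom-increasing k v (x ∷ u) with x ≡ᵇ v
... | false = positionsFrom-increasing (suc k) v u
... | true  =
  increasing-∷ (positionsFrom (suc k) v u) (positionsFrom-increasing (suc k) v u) (positionsFrom-≥ (suc k) v u)
  where
  increasing-∷ : ∀ l → T (strictlyIncreasing l) → All (k <_) l → T (strictlyIncreasing (k ∷ l))
  increasing-∷ []      _ _         = tt
  increasing-∷ (y ∷ l) t (k<y ∷ _) = ∧-intro (<⇒<ᵇ k<y) t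

length-positionsFrom : ∀ k v u → length (positionsFrom k v u) ≡ count (_≡ᵇ v) u
length-positionsFrom k v []      = refl
length-positionsFrom k v (x ∷ u) with x ≡ᵇ v
... | true  = cong suc (length-positionsFrom (suc k) v u)
... | false = length-positionsFrom (suc k) v u

positionsFrom-+ : ∀ i k v u → positionsFrom (i + k) v u ≡ map (i +_) (positionsFrom k v u)
positionsFrom-+ i k v []      = refl
positionsFrom-+ i k v (x ∷ u) rewrite sym (+-suc i k) | positionsFrom-+ i (suc k) v u with x ≡ᵇ v
... | true  = refl
... | false = refl

positionsFrom-none : ∀ k v {u} → All (λ x → (x ≡ᵇ v) ≡ false) u → positionsFrom k v u ≡ []
positionsFrom-none k v []              = refl
positionsFrom-none k v (x≢v ∷ rest) rewrite x≢v = positionsFrom-none (suc k) v rest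

positionsFrom-map : ∀ (g : ℕ → ℕ) k v w {u} → All (λ x → (g x ≡ᵇ v) ≡ (x ≡ᵇ w)) u →
                    positionsFrom k v (map g u) ≡ positionsFrom k w u
positionsFrom-map g k v w []                  = refl
positionsFrom-map g k v w {x ∷ _} (same ∷ rest) rewrite same | positionsFrom-map g (suc k) v w rest with x ≡ᵇ w
... | true  = refl
... | false = refl

positionsFrom-map-range : ∀ (g : ℕ → ℕ) k n v →
                          positionsFrom k v (map g (range k n)) ≡ filterᵇ (λ j → g j ≡ᵇ v) (range k n)
positionsFrom-map-range g k zero    v = refl
positionsFrom-map-range g k (suc n) v rewrite positionsFrom-map-range g (suc k) n v with g k ≡ᵇ v
... | true  = refl
... | false = refl

count≤-suc : ∀ j u → count≤ (suc j) u ≡ count≤ j u + count (_≡ᵇ suc j) u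
count≤-suc j []      = refl
count≤-suc j (x ∷ u) with <-cmp x (suc j)
... | tri< x≤j _ _
  rewrite ≤ᵇ-true (<⇒≤ x≤j) | ≤ᵇ-true (s≤s⁻¹ x≤j) | ≡ᵇ-false (<⇒≢ x≤j) = cong suc (count≤-suc j u)
... | tri≈ _ refl _
  rewrite ≤ᵇ-true (≤-refl {suc j}) | ≤ᵇ-false (≤-refl {suc j}) | ≡ᵇ-refl (suc j) =
  trans (cong suc (count≤-suc j u)) (sym (+-suc _ _))
... | tri> _ _ x>1+j
  rewrite ≤ᵇ-false x>1+j | ≤ᵇ-false (<-trans (n<1+n j) x>1+j) | ≡ᵇ-false (>⇒≢ x>1+j) = count≤-suc j u

count≤-0 : ∀ {u} → All (1 ≤_) u → count≤ 0 u ≡ 0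
count≤-0 positive = count-none _ (All.map ≤ᵇ-false positive)

-- |A_1| + … + |A_i| = #{j : a_j ≤ i}.
prefixCondition-intro : ∀ j N a → (∀ i → j < i → i ≤ j + N → i ≤ count≤ i a) →
                        T (prefixCondition j (count≤ j a) (blocks a (range (suc j) N)))
prefixCondition-intro j zero    a enough = tt
prefixCondition-intro j (suc N) a enough rewrite length-positionsFrom 1 (suc j) a | sym (count≤-suc j a) =
  ∧-intro (≤⇒≤ᵇ (enough (suc j) ≤-refl (subst (suc j ≤_) (sym (+-suc j N)) (s≤s (m≤m+n j N)))))
          (prefixCondition-intro (suc j) N a
             (λ i j<i i≤ → enough i (<-trans (n<1+n j) j<i) (subst (i ≤_) (sym (+-suc j N)) i≤)))

prefixCondition-elim : ∀ j N a → T (prefixCondition j (count≤ j a) (blocks a (range (suc j) N))) →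
                       ∀ i → j < i → i ≤ j + N → i ≤ count≤ i a
prefixCondition-elim j zero    a t i j<i i≤j+0 = ⊥-elim (<⇒≱ j<i (subst (i ≤_) (+-identityʳ j) i≤j+0))
prefixCondition-elim j (suc N) a t i j<i i≤
  rewrite length-positionsFrom 1 (suc j) a | sym (count≤-suc j a) with suc j ≟ i
... | yes refl = ≤ᵇ⇒≤ (suc j) _ (proj₁ (∧-elim t))
... | no 1+j≢i =
  prefixCondition-elim (suc j) N a (proj₂ (∧-elim t)) i (≤∧≢⇒< j<i 1+j≢i) (subst (i ≤_) (+-suc j N) i≤)

concat-blocks↭ : ∀ k vs u → All (λ x → occurrences x vs ≡ 1) u →
                 concat (map (λ v → positionsFrom k v u) vs) ↭ range k (length u)
concat-blocks↭ k vs []      _             = ↭-reflexive (concat-[] vs)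
  where
  concat-[] : ∀ vs → concat (map (λ v → positionsFrom k v []) vs) ≡ []
  concat-[] []       = refl
  concat-[] (_ ∷ vs) = concat-[] vs
concat-blocks↭ k vs (x ∷ u) (once ∷ rest) =
  ↭-trans (insert↭ vs once) (prep k (concat-blocks↭ (suc k) vs u rest))
  where
  g : ℕ → List ℕ
  g v = positionsFrom (suc k) v u
  insert↭ : ∀ vs → occurrences x vs ≡ 1 →
            concat (map (λ v → if x ≡ᵇ v then k ∷ g v else g v) vs) ↭ k ∷ concat (map g vs)
  insert↭ (w ∷ vs) once with x ≡ᵇ w
  ... | true  = ↭-reflexive (cong (λ z → k ∷ g w ++ concat z)
                  (map-cong-local (All.map (λ {v} x≢v → cong (λ b → if b then k ∷ g v else g v) x≢v)
                                           (count≡0⇒none (x ≡ᵇ_) vs (suc-injective once)))))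
  ... | false = ↭-trans (++⁺ˡ (g w) (insert↭ vs once)) (shift k (g w) _)

occurrences-range : ∀ x k n → k ≤ x → x < k + n → occurrences x (range k n) ≡ 1
occurrences-range x k zero    k≤x x< = ⊥-elim (out-of-empty-range k≤x x<)
occurrences-range x k (suc n) k≤x x< with k ≟ x
... | yes refl rewrite ≡ᵇ-refl k =
  cong suc (count-none _ (All.map (λ (k<j , _) → ≡ᵇ-false (<⇒≢ k<j)) (range-bounds (suc k) n)))
... | no k≢x rewrite ≡ᵇ-false (k≢x ∘ sym) = occurrences-range x (suc k) n (≤∧≢⇒< k≤x k≢x) (<-+-suc x<)

parkingWord-letters : ∀ a → T (isParkingWord a) → All (λ x → 1 ≤ x × x ≤ length a) a
parkingWord-letters []          t = []
parkingWord-letters a@(_ ∷ _) t =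
  All.zip (isParkingWord⇒positive a t ,
           All.map (λ {x} e → ≤ᵇ⇒≤ x (length a) (≡true⇒T e))
                   (count-full⇒all _ a (isParkingWord⇒counts a t (length a) (s≤s z≤n) ≤-refl)))

elem-none : ∀ j {l} → All (λ y → (j ≡ᵇ y) ≡ false) l → elemℕ j l ≡ false
elem-none j []              = refl
elem-none j (j≢y ∷ rest) rewrite j≢y = elem-none j rest

elem-false⇒occurrences≡0 : ∀ j l → elemℕ j l ≡ false → occurrences j l ≡ 0
elem-false⇒occurrences≡0 j []      _ = refl
elem-false⇒occurrences≡0 j (y ∷ l) e with j ≡ᵇ y
... | false = elem-false⇒occurrences≡0 j l e

elem-true⇒occurrences≥1 : ∀ j l → elemℕ j l ≡ true → 1 ≤ occurrences j l
elem-true⇒occurrences≥1 j (y ∷ l) e with j ≡ᵇ y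
... | true  = s≤s z≤n
... | false = elem-true⇒occurrences≥1 j l e

toPF-isParkingFunction : ∀ a → T (isParkingWord a) → T (isParkingFunction (toPF a))
toPF-isParkingFunction a t rewrite length-toPF a = ∧-intro (∧-intro increasing (≡⇒eqListℕ sorted)) prefix
  where
  n = length a
  increasing : T (all strictlyIncreasing (toPF a))
  increasing = all⁻ strictlyIncreasing (All.map⁺ (All.universal (λ v → positionsFrom-increasing 1 v a) (range 1 n)))
  perm : concat (toPF a) ↭ range 1 n
  perm = concat-blocks↭ 1 (range 1 n) a
           (All.map (λ (1≤x , x≤n) → occurrences-range _ 1 n 1≤x (s≤s x≤n)) (parkingWord-letters a t))
  sorted : sortℕ (concat (toPF a)) ≡ interval n
  sorted = trans (sorted-↭⇒≡ (sortℕ-sorted (concat (toPF a))) (range-sorted 1 n) (↭-trans (sortℕ-↭ _) perm))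
                 (sym (interval≡range n))
  prefix : T (prefixCondition 0 0 (toPF a))
  prefix = subst (λ s → T (prefixCondition 0 s (toPF a))) (count≤-0 (isParkingWord⇒positive a t))
                 (prefixCondition-intro 0 n a (isParkingWord⇒counts a t))

elem-positionsFrom : ∀ k u j → k ≤ j → j < k + length u →
                     ∀ w → elemℕ j (positionsFrom k w u) ≡ (lookupFrom 0 k u j ≡ᵇ w)
elem-positionsFrom k []      j k≤j j< w = ⊥-elim (out-of-empty-range k≤j j<)
elem-positionsFrom k (x ∷ u) j k≤j j< w with j ≟ k
... | yes refl rewrite ≡ᵇ-refl j with x ≡ᵇ w
...   | true  rewrite ≡ᵇ-refl j = refl
...   | false = elem-none j (All.map (λ j<y → ≡ᵇ-false (<⇒≢ j<y)) (positionsFrom-≥ (suc j) w u))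
elem-positionsFrom k (x ∷ u) j k≤j j< w | no j≢k rewrite ≡ᵇ-false j≢k with x ≡ᵇ w
... | true  rewrite ≡ᵇ-false j≢k = elem-positionsFrom (suc k) u j (≤∧≢⇒< k≤j (j≢k ∘ sym)) (<-+-suc j<) w
... | false = elem-positionsFrom (suc k) u j (≤∧≢⇒< k≤j (j≢k ∘ sym)) (<-+-suc j<) w

blockIndexFrom-blocks : ∀ a k N j c → (∀ w → elemℕ j (positionsFrom 1 w a) ≡ (c ≡ᵇ w)) →
                        k ≤ c → c < k + N → blockIndexFrom k j (blocks a (range k N)) ≡ c
blockIndexFrom-blocks a k zero    j c j∈c k≤c c< = ⊥-elim (out-of-empty-range k≤c c<)
blockIndexFrom-blocks a k (suc N) j c j∈c k≤c c< with k ≟ c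
... | yes refl rewrite j∈c k | ≡ᵇ-refl k = refl
... | no k≢c   rewrite j∈c k | ≡ᵇ-false (k≢c ∘ sym) =
  blockIndexFrom-blocks a (suc k) N j c j∈c (≤∧≢⇒< k≤c k≢c) (<-+-suc c<)

toWord-toPF : ∀ a → T (isParkingWord a) → toWord (toPF a) ≡ a
toWord-toPF a t rewrite length-toPF a =
  trans (map-cong-local (All.map (λ {j} (1≤j , j<) → letter j 1≤j j<) (range-bounds 1 (length a))))
        (map-lookupFrom-range 0 1 a)
  where
  letter : ∀ j → 1 ≤ j → j < 1 + length a → blockIndexFrom 1 j (toPF a) ≡ lookupFrom 0 1 a j
  letter j 1≤j j< with lookupFrom-All 0 1 a j (parkingWord-letters a t) 1≤j j<
  ... | (1≤c , c≤n) = blockIndexFrom-blocks a 1 (length a) j _ (elem-positionsFrom 1 a j 1≤j j<) 1≤c (s≤s c≤n)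

blockIndexFrom-≥ : ∀ k j Φ → k ≤ blockIndexFrom k j Φ
blockIndexFrom-≥ k j []      = ≤-refl
blockIndexFrom-≥ k j (B ∷ Φ) with elemℕ j B
... | true  = ≤-refl
... | false = <⇒≤ (blockIndexFrom-≥ (suc k) j Φ)

module _ Φ (t : T (isParkingFunction Φ)) where
  private
    composition : T (isWeakSetCompositionOf (length Φ) Φ) × T (prefixCondition 0 0 Φ)
    composition = ∧-elim {isWeakSetCompositionOf (length Φ) Φ} t
    blocksAndUnion : T (all strictlyIncreasing Φ) × T (eqListℕ (sortℕ (concat Φ)) (interval (length Φ)))
    blocksAndUnion = ∧-elim {all strictlyIncreasing Φ} (proj₁ composition)

  parkingFunction-increasing : All (λ B → T (strictlyIncreasing B)) Φ
  parkingFunction-increasing = all⁺ strictlyIncreasing Φ (proj₁ blocksAndUnion)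

  parkingFunction-↭ : concat Φ ↭ range 1 (length Φ)
  parkingFunction-↭ = ↭-trans (↭-sym (sortℕ-↭ (concat Φ)))
    (↭-reflexive (trans (eqListℕ⇒≡ _ _ (proj₂ blocksAndUnion)) (interval≡range (length Φ))))

  parkingFunction-prefix : T (prefixCondition 0 0 Φ)
  parkingFunction-prefix = proj₂ composition

increasing-head : ∀ x B → T (strictlyIncreasing (x ∷ B)) → All (x <_) B
increasing-head x []      t = []
increasing-head x (y ∷ B) t with ∧-elim t
... | x<ᵇy , t′ = x<y ∷ All.map (<-trans x<y) (increasing-head y B t′)
  where
  x<y : x < y
  x<y = <ᵇ⇒< x y x<ᵇy

increasing-tail : ∀ x B → T (strictlyIncreasing (x ∷ B)) → T (strictlyIncreasing B)
increasing-tail x []      t = tt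
increasing-tail x (y ∷ B) t = proj₂ (∧-elim t)

filter-elem-increasing : ∀ k N B → T (strictlyIncreasing B) → All (λ x → k ≤ x × x < k + N) B →
                         filterᵇ (λ j → elemℕ j B) (range k N) ≡ B
filter-elem-increasing k N       []      t bounds = filterᵇ-none _ (All.universal (λ _ → refl) (range k N))
filter-elem-increasing k zero    (x ∷ B) t ((k≤x , x<) ∷ _) = ⊥-elim (out-of-empty-range k≤x x<)
filter-elem-increasing k (suc N) (x ∷ B) t ((k≤x , x<) ∷ bounds) with k ≟ x
... | yes refl rewrite ≡ᵇ-refl k =
  cong (k ∷_)
    (trans (filterᵇ-cong-local _ _ (All.map (λ {j} (k<j , _) → drop-head {j} (≡ᵇ-false (>⇒≢ k<j)))
                                            (range-bounds (suc k) N)))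
           (filter-elem-increasing (suc k) N B (increasing-tail k B t)
              (All.map (λ (k<y , _ , y<) → k<y , <-+-suc y<) (All.zip (increasing-head k B t , bounds)))))
  where
  drop-head : ∀ {j} → (j ≡ᵇ k) ≡ false → ((j ≡ᵇ k) ∨ elemℕ j B) ≡ elemℕ j B
  drop-head j≢k rewrite j≢k = refl
... | no k≢x = skip (k<x ∷ All.map (<-trans k<x) (increasing-head x B t))
  where
  k<x : k < x
  k<x = ≤∧≢⇒< k≤x k≢x
  skip : All (k <_) (x ∷ B) → filterᵇ (λ j → elemℕ j (x ∷ B)) (range k (suc N)) ≡ x ∷ B
  skip above rewrite elem-none k (All.map (λ k<y → ≡ᵇ-false (<⇒≢ k<y)) above) =
    filter-elem-increasing (suc k) N (x ∷ B) t
      (All.map (λ (k<y , _ , y<) → k<y , <-+-suc y<) (All.zip (above , (k≤x , x<) ∷ bounds)))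

elem-lookupFrom-none : ∀ j k Φ v → occurrences j (concat Φ) ≡ 0 → elemℕ j (lookupFrom [] k Φ v) ≡ false
elem-lookupFrom-none j k []      v _    = refl
elem-lookupFrom-none j k (B ∷ Φ) v none with v ≡ᵇ k
... | true  = elem-none j (count≡0⇒none (j ≡ᵇ_) B (m+n≡0⇒m≡0 _ none-in-B++Φ))
  where
  none-in-B++Φ : occurrences j B + occurrences j (concat Φ) ≡ 0
  none-in-B++Φ = trans (sym (count-++ _ B (concat Φ))) none
... | false = elem-lookupFrom-none j (suc k) Φ v (m+n≡0⇒n≡0 _ (trans (sym (count-++ _ B (concat Φ))) none))

blockIndexFrom≡ᵇ : ∀ k Φ j → occurrences j (concat Φ) ≡ 1 → ∀ v → k ≤ v → v < k + length Φ →
                   (blockIndexFrom k j Φ ≡ᵇ v) ≡ elemℕ j (lookupFrom [] k Φ v)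
blockIndexFrom≡ᵇ k []      j once v k≤v v< = ⊥-elim (out-of-empty-range k≤v v<)
blockIndexFrom≡ᵇ k (B ∷ Φ) j once v k≤v v< with elemℕ j B in j∈B | k ≟ v
... | true  | yes refl rewrite ≡ᵇ-refl k = sym j∈B
... | true  | no k≢v rewrite ≡ᵇ-false k≢v | ≡ᵇ-false (k≢v ∘ sym) =
  sym (elem-lookupFrom-none j (suc k) Φ v rest-none)
  where
  rest-none : occurrences j (concat Φ) ≡ 0
  rest-none with occurrences j B | elem-true⇒occurrences≥1 j B j∈B | trans (sym (count-++ _ B (concat Φ))) once
  ... | suc c | _ | e = m+n≡0⇒n≡0 c (suc-injective e)
... | false | yes refl rewrite ≡ᵇ-refl k = trans (≡ᵇ-false (>⇒≢ (blockIndexFrom-≥ (suc k) j Φ))) (sym j∈B)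
... | false | no k≢v rewrite ≡ᵇ-false (k≢v ∘ sym) =
  blockIndexFrom≡ᵇ (suc k) Φ j rest-once v (≤∧≢⇒< k≤v k≢v) (<-+-suc v<)
  where
  rest-once : occurrences j (concat Φ) ≡ 1
  rest-once = trans (cong (_+ _) (sym (elem-false⇒occurrences≡0 j B j∈B)))
                    (trans (sym (count-++ _ B (concat Φ))) once)

toPF-toWord : ∀ Φ → T (isParkingFunction Φ) → toPF (toWord Φ) ≡ Φ
toPF-toWord Φ t rewrite length-toWord Φ =
  trans (map-cong-local (All.map (λ {v} (1≤v , v<) → block v 1≤v v<) (range-bounds 1 n)))
        (map-lookupFrom-range [] 1 Φ)
  where
  n = length Φ
  perm : concat Φ ↭ range 1 n
  perm = parkingFunction-↭ Φ t
  bounds : All (All (λ x → 1 ≤ x × x < 1 + n)) Φ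
  bounds = concat⁻ (All-resp-↭ (↭-sym perm) (range-bounds 1 n))
  increasing : All (λ B → T (strictlyIncreasing B)) Φ
  increasing = parkingFunction-increasing Φ t
  block : ∀ v → 1 ≤ v → v < 1 + n → positionsFrom 1 v (toWord Φ) ≡ lookupFrom [] 1 Φ v
  block v 1≤v v< = begin
    positionsFrom 1 v (toWord Φ)
      ≡⟨ positionsFrom-map-range _ 1 n v ⟩
    filterᵇ (λ j → blockIndexFrom 1 j Φ ≡ᵇ v) (range 1 n)
      ≡⟨ filterᵇ-cong-local _ _ (All.map (λ {j} (1≤j , j<) →
           blockIndexFrom≡ᵇ 1 Φ j (trans (count-↭ _ perm) (occurrences-range j 1 n 1≤j j<)) v 1≤v v<)
           (range-bounds 1 n)) ⟩
    filterᵇ (λ j → elemℕ j (lookupFrom [] 1 Φ v)) (range 1 n)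
      ≡⟨ filter-elem-increasing 1 n _ (lookupFrom-All [] 1 Φ v increasing 1≤v v<)
                                      (lookupFrom-All [] 1 Φ v bounds 1≤v v<) ⟩
    lookupFrom [] 1 Φ v ∎
    where open ≡-Reasoning

toWord-isParkingWord : ∀ Φ → T (isParkingFunction Φ) → T (isParkingWord (toWord Φ))
toWord-isParkingWord Φ t = isParkingWord-intro positive counts
  where
  a = toWord Φ
  positive : All (1 ≤_) a
  positive = All.map⁺ (All.universal (λ j → blockIndexFrom-≥ 1 j Φ) (range 1 (length Φ)))
  prefix : T (prefixCondition 0 (count≤ 0 a) (toPF a))
  prefix = subst₂ (λ s Ψ → T (prefixCondition 0 s Ψ)) (sym (count≤-0 positive)) (sym (toPF-toWord Φ t))
                  (parkingFunction-prefix Φ t)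
  counts : HasParkingCounts a
  counts = prefixCondition-elim 0 (length a) a prefix

-- Shuffles and subsets

-- true: the next letter comes from the left word; false: from the right word.
data Mask : List Bool → ℕ → ℕ → Set where
  mnil   : Mask [] 0 0
  mleft  : ∀ {σ s t} → Mask σ s t → Mask (true ∷ σ) (suc s) t
  mright : ∀ {σ s t} → Mask σ s t → Mask (false ∷ σ) s (suc t)

masks : ℕ → ℕ → List (List Bool)
masks zero    t       = replicate t false ∷ []
masks (suc s) zero    = replicate (suc s) true ∷ []
masks (suc s) (suc t) = map (true ∷_) (masks s (suc t)) ++ map (false ∷_) (masks (suc s) t)

select : List Bool → List ℕ → List ℕ
select []          _       = []
select (b ∷ σ)     []      = []
select (true ∷ σ)  (x ∷ l) = x ∷ select σ l
select (false ∷ σ) (x ∷ l) = select σ l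

merge : List Bool → List ℕ → List ℕ → List ℕ
merge []          a       b       = []
merge (true ∷ σ)  []      b       = []
merge (true ∷ σ)  (x ∷ a) b       = x ∷ merge σ a b
merge (false ∷ σ) a       []      = []
merge (false ∷ σ) a       (y ∷ b) = y ∷ merge σ a b

masks-Mask : ∀ s t → All (λ σ → Mask σ s t) (masks s t)
masks-Mask zero    t       = all-right t ∷ []
  where
  all-right : ∀ t → Mask (replicate t false) 0 t
  all-right zero    = mnil
  all-right (suc t) = mright (all-right t)
masks-Mask (suc s) zero    = all-left (suc s) ∷ []
  where
  all-left : ∀ s → Mask (replicate s true) s 0
  all-left zero    = mnil
  all-left (suc s) = mleft (all-left s)
masks-Mask (suc s) (suc t) =
  All.++⁺ (All.map⁺ (All.map mleft (masks-Mask s (suc t)))) (All.map⁺ (All.map mright (masks-Mask (suc s) t)))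

Mask-length : ∀ {σ s t} → Mask σ s t → length σ ≡ s + t
Mask-length mnil       = refl
Mask-length (mleft m)  = cong suc (Mask-length m)
Mask-length {t = suc t} (mright {s = s} m) = trans (cong suc (Mask-length m)) (sym (+-suc s t))

Mask-not : ∀ {σ s t} → Mask σ s t → Mask (map not σ) t s
Mask-not mnil       = mnil
Mask-not (mleft m)  = mright (Mask-not m)
Mask-not (mright m) = mleft (Mask-not m)

shuffle≡merges : ∀ a b → shuffle a b ≡ map (λ σ → merge σ a b) (masks (length a) (length b))
shuffle≡merges []      b       = cong (_∷ []) (sym (merge-right b))
  where
  merge-right : ∀ b → merge (replicate (length b) false) [] b ≡ b
  merge-right []      = refl
  merge-right (y ∷ b) = cong (y ∷_) (merge-right b)
shuffle≡merges (x ∷ a) []      = cong (_∷ []) (sym (merge-left (x ∷ a)))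
  where
  merge-left : ∀ a → merge (replicate (length a) true) a [] ≡ a
  merge-left []      = refl
  merge-left (x ∷ a) = cong (x ∷_) (merge-left a)
shuffle≡merges (x ∷ a) (y ∷ b) = begin
  map (x ∷_) (shuffle a (y ∷ b)) ++ map (y ∷_) (shuffle (x ∷ a) b)
    ≡⟨ cong₂ (λ l r → map (x ∷_) l ++ map (y ∷_) r) (shuffle≡merges a (y ∷ b)) (shuffle≡merges (x ∷ a) b) ⟩
  map (x ∷_) (map (λ σ → merge σ a (y ∷ b)) L) ++ map (y ∷_) (map (λ σ → merge σ (x ∷ a) b) R)
    ≡⟨ cong₂ _++_ (sym (map-∘ L)) (sym (map-∘ R)) ⟩
  map (λ σ → merge (true ∷ σ) (x ∷ a) (y ∷ b)) L ++ map (λ σ → merge (false ∷ σ) (x ∷ a) (y ∷ b)) R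
    ≡⟨ cong₂ _++_ (map-∘ L) (map-∘ R) ⟩
  map (λ σ → merge σ (x ∷ a) (y ∷ b)) (map (true ∷_) L) ++ map (λ σ → merge σ (x ∷ a) (y ∷ b)) (map (false ∷_) R)
    ≡⟨ sym (map-++ _ (map (true ∷_) L) _) ⟩
  map (λ σ → merge σ (x ∷ a) (y ∷ b)) (masks (suc (length a)) (suc (length b))) ∎
  where
  open ≡-Reasoning
  L = masks (length a) (suc (length b))
  R = masks (suc (length a)) (length b)

choose-short : ∀ k L → length L < k → choose k L ≡ []
choose-short (suc k) []      _   = refl
choose-short (suc k) (x ∷ L) ∣L∣<k
  rewrite choose-short k L (s≤s⁻¹ ∣L∣<k) | choose-short (suc k) L (<-trans (n<1+n _) ∣L∣<k) = refl

choose≡selections : ∀ s t L → length L ≡ s + t → choose s L ≡ map (λ σ → select σ L) (masks s t)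
choose≡selections zero    t       L       _ = cong (_∷ []) (sym (select-none t L))
  where
  select-none : ∀ t L → select (replicate t false) L ≡ []
  select-none zero    L       = refl
  select-none (suc t) []      = refl
  select-none (suc t) (x ∷ L) = select-none t L
choose≡selections (suc s) zero    (x ∷ L) ∣L∣≡ = begin
  map (x ∷_) (choose s L) ++ choose (suc s) L
    ≡⟨ cong (map (x ∷_) (choose s L) ++_) (choose-short (suc s) L (≤-reflexive (cong suc ∣L∣≡s))) ⟩
  map (x ∷_) (choose s L) ++ []
    ≡⟨ ++-identityʳ _ ⟩
  map (x ∷_) (choose s L)
    ≡⟨ cong (map (x ∷_)) (choose≡selections s zero L (suc-injective ∣L∣≡)) ⟩
  map (x ∷_) (map (λ σ → select σ L) (masks s 0))
    ≡⟨ cong (λ ms → map (x ∷_) (map (λ σ → select σ L) ms)) (masks-s-0 s) ⟩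
  map (λ σ → select σ (x ∷ L)) (masks (suc s) zero) ∎
  where
  open ≡-Reasoning
  ∣L∣≡s : length L ≡ s
  ∣L∣≡s = trans (suc-injective ∣L∣≡) (+-identityʳ s)
  masks-s-0 : ∀ s → masks s 0 ≡ replicate s true ∷ []
  masks-s-0 zero    = refl
  masks-s-0 (suc s) = refl
choose≡selections (suc s) (suc t) (x ∷ L) ∣L∣≡ = begin
  map (x ∷_) (choose s L) ++ choose (suc s) L
    ≡⟨ cong₂ _++_ (cong (map (x ∷_)) (choose≡selections s (suc t) L (suc-injective ∣L∣≡)))
                  (choose≡selections (suc s) t L (trans (suc-injective ∣L∣≡) (+-suc s t))) ⟩
  map (x ∷_) (map (λ σ → select σ L) Lm) ++ map (λ σ → select σ L) Rm
    ≡⟨ cong (_++ map (λ σ → select σ L) Rm) (sym (map-∘ Lm)) ⟩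
  map (λ σ → select (true ∷ σ) (x ∷ L)) Lm ++ map (λ σ → select (false ∷ σ) (x ∷ L)) Rm
    ≡⟨ cong₂ _++_ (map-∘ Lm) (map-∘ Rm) ⟩
  map (λ σ → select σ (x ∷ L)) (map (true ∷_) Lm) ++ map (λ σ → select σ (x ∷ L)) (map (false ∷_) Rm)
    ≡⟨ sym (map-++ _ (map (true ∷_) Lm) _) ⟩
  map (λ σ → select σ (x ∷ L)) (masks (suc s) (suc t)) ∎
  where
  open ≡-Reasoning
  Lm = masks s (suc t)
  Rm = masks (suc s) t

select-All : ∀ {P : ℕ → Set} σ {L} → All P L → All P (select σ L)
select-All []          _          = []
select-All (b ∷ σ)     []         = []
select-All (true ∷ σ)  (px ∷ pxs) = px ∷ select-All σ pxs
select-All (false ∷ σ) (px ∷ pxs) = select-All σ pxs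

complement-select : ∀ k σ → let L = range k (length σ) in
                    filterᵇ (λ x → not (elemℕ x (select σ L))) L ≡ select (map not σ) L
complement-select k []          = refl
complement-select k (true ∷ σ)  rewrite ≡ᵇ-refl k =
  trans (filterᵇ-cong-local _ _ (All.map (λ {x} (k<x , _) → drop-head {x} (≡ᵇ-false (>⇒≢ k<x))) (range-bounds (suc k) (length σ))))
        (complement-select (suc k) σ)
  where
  drop-head : ∀ {x} → (x ≡ᵇ k) ≡ false →
              not ((x ≡ᵇ k) ∨ elemℕ x (select σ (range (suc k) (length σ)))) ≡ not (elemℕ x (select σ (range (suc k) (length σ))))
  drop-head x≢k rewrite x≢k = refl
complement-select k (false ∷ σ)
  rewrite elem-none k (select-All σ (All.map (λ (k<x , _) → ≡ᵇ-false (<⇒≢ k<x)) (range-bounds (suc k) (length σ)))) =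
  cong (k ∷_) (complement-select (suc k) σ)

merge-swap : ∀ σ a b → merge σ a b ≡ merge (map not σ) b a
merge-swap []          a       b       = refl
merge-swap (true ∷ σ)  []      b       = refl
merge-swap (true ∷ σ)  (x ∷ a) b       = cong (x ∷_) (merge-swap σ a b)
merge-swap (false ∷ σ) a       []      = refl
merge-swap (false ∷ σ) a       (y ∷ b) = cong (y ∷_) (merge-swap σ a b)

merge-All : ∀ {P : ℕ → Set} σ {a b} → All P a → All P b → All P (merge σ a b)
merge-All []          _          _          = []
merge-All (true ∷ σ)  []         _          = []
merge-All (true ∷ σ)  (px ∷ pa) pb         = px ∷ merge-All σ pa pb
merge-All (false ∷ σ) _          []         = []
merge-All (false ∷ σ) pa         (py ∷ pb) = py ∷ merge-All σ pa pb

length-merge : ∀ σ a b → Mask σ (length a) (length b) → length (merge σ a b) ≡ length a + length b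
length-merge []          []      []      mnil       = refl
length-merge (true ∷ σ)  (x ∷ a) b       (mleft m)  = cong suc (length-merge σ a b m)
length-merge (false ∷ σ) a       (y ∷ b) (mright m) =
  trans (cong suc (length-merge σ a b m)) (sym (+-suc (length a) (length b)))

count-merge : ∀ p σ a b → Mask σ (length a) (length b) → count p (merge σ a b) ≡ count p a + count p b
count-merge p []          []      []      mnil       = refl
count-merge p (true ∷ σ)  (x ∷ a) b       (mleft m)  =
  trans (count-∷ p x (merge σ a b))
        (trans (cong (indicator (p x) +_) (count-merge p σ a b m))
               (trans (sym (+-assoc (indicator (p x)) _ _)) (cong (_+ count p b) (sym (count-∷ p x a)))))
count-merge p (false ∷ σ) a       (y ∷ b) (mright m) =
  trans (count-∷ p y (merge σ a b))
        (trans (cong (indicator (p y) +_) (count-merge p σ a b m))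
               (trans (x∙yz≈y∙xz (indicator (p y)) (count p a) (count p b))
                      (cong (count p a +_) (sym (count-∷ p y b)))))

nth-∷-positions : ∀ x S v a → map (nth (x ∷ S)) (positionsFrom 2 v a) ≡ map (nth S) (positionsFrom 1 v a)
nth-∷-positions x S v a = begin
  map (nth (x ∷ S)) (positionsFrom 2 v a)           ≡⟨ cong (map _) (positionsFrom-+ 1 1 v a) ⟩
  map (nth (x ∷ S)) (map suc (positionsFrom 1 v a)) ≡⟨ sym (map-∘ _) ⟩
  map (nth (x ∷ S) ∘ suc) (positionsFrom 1 v a)     ≡⟨ map-cong-local (All.map (λ { {suc p} _ → refl }) (positionsFrom-≥ 1 v a)) ⟩
  map (nth S) (positionsFrom 1 v a)                 ∎
  where open ≡-Reasoning

positionsFrom-merge : ∀ σ a b k v → Mask σ (length a) (length b) → All (λ y → (y ≡ᵇ v) ≡ false) b →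
                      positionsFrom k v (merge σ a b) ≡ map (nth (select σ (range k (length σ)))) (positionsFrom 1 v a)
positionsFrom-merge []          []      b       k v _          _ = refl
positionsFrom-merge (true ∷ σ)  (x ∷ a) b       k v (mleft m)  avoid with x ≡ᵇ v
... | true  = cong (k ∷_) (trans (positionsFrom-merge σ a b (suc k) v m avoid) (sym (nth-∷-positions k _ v a)))
... | false = trans (positionsFrom-merge σ a b (suc k) v m avoid) (sym (nth-∷-positions k _ v a))
positionsFrom-merge (false ∷ σ) a       (y ∷ b) k v (mright m) (y≢v ∷ avoid) rewrite y≢v =
  positionsFrom-merge σ a b (suc k) v m avoid

count≤-+ : ∀ s j b → count≤ (s + j) (map (s +_) b) ≡ count≤ j b
count≤-+ s j b = count-map _ _ (s +_) (All.universal (λ y → ≤ᵇ-cong-⇔ (+-cancelˡ-≤ s y j) (+-monoʳ-≤ s)) b)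

module _ (σ : List Bool) (a b : List ℕ) (a-pw : T (isParkingWord a)) (b-pw : T (isParkingWord b))
         (mask : Mask σ (length a) (length b)) where
  private
    s  = length a
    t  = length b
    b′ = map (s +_) b
    c  = merge σ a b′

    mask′ : Mask σ s (length b′)
    mask′ = subst (Mask σ s) (sym (length-map (s +_) b)) mask

    length-c : length c ≡ s + t
    length-c = trans (length-merge σ a b′ mask′) (cong (s +_) (length-map (s +_) b))

  merge-isParkingWord : T (isParkingWord (merge σ a (map (length a +_) b)))
  merge-isParkingWord = isParkingWord-intro positive counts
    where
    positive : All (1 ≤_) c
    positive = merge-All σ (isParkingWord⇒positive a a-pw)
                           (All.map⁺ (All.map (λ {y} 1≤y → ≤-trans 1≤y (m≤n+m y s)) (isParkingWord⇒positive b b-pw)))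
    counts : HasParkingCounts c
    counts j 1≤j j≤∣c∣ rewrite count-merge (_≤ᵇ j) σ a b′ mask′ with j ≤? s
    ... | yes j≤s = ≤-trans (isParkingWord⇒counts a a-pw j 1≤j j≤s) (m≤m+n _ _)
    ... | no  j≰s = subst (λ i → i ≤ count≤ i a + count≤ i b′) (m+[n∸m]≡n s≤j) (begin
      s + (j ∸ s)                             ≤⟨ +-monoʳ-≤ s (isParkingWord⇒counts b b-pw (j ∸ s) 1≤j∸s j∸s≤t) ⟩
      s + count≤ (j ∸ s) b                    ≡⟨ cong₂ _+_ (sym all-of-a) (sym (count≤-+ s (j ∸ s) b)) ⟩
      count≤ j′ a + count≤ j′ b′               ∎)
      where
      open ≤-Reasoning
      s≤j : s ≤ j
      s≤j = <⇒≤ (≰⇒> j≰s)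
      j′ = s + (j ∸ s)
      1≤j∸s : 1 ≤ j ∸ s
      1≤j∸s = m+n≤o⇒m≤o∸n 1 (≰⇒> j≰s)
      j∸s≤t : j ∸ s ≤ t
      j∸s≤t = subst (j ∸ s ≤_) (m+n∸m≡n s t) (∸-monoˡ-≤ s (subst (j ≤_) length-c j≤∣c∣))
      all-of-a : count≤ j′ a ≡ s
      all-of-a = count-all _ (All.map (λ (_ , x≤s) → ≤ᵇ-true (≤-trans x≤s (m≤m+n s (j ∸ s)))) (parkingWord-letters a a-pw))

  private
    L = range 1 (length σ)

  positionsFrom-merge-left : ∀ {v} → v ≤ s → positionsFrom 1 v c ≡ map (nth (select σ L)) (positionsFrom 1 v a)
  positionsFrom-merge-left {v} v≤s = positionsFrom-merge σ a b′ 1 v mask′ avoid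
    where
    avoid : All (λ y → (y ≡ᵇ v) ≡ false) b′
    avoid = All.map⁺ (All.map (λ 1≤y → ≡ᵇ-false (>⇒≢ (≤-<-trans v≤s (m<m+n s 1≤y)))) (isParkingWord⇒positive b b-pw))

  positionsFrom-merge-right : ∀ {w} → 1 ≤ w → positionsFrom 1 (s + w) c ≡ map (nth (select (map not σ) L)) (positionsFrom 1 w b)
  positionsFrom-merge-right {w} 1≤w = begin
    positionsFrom 1 (s + w) c
      ≡⟨ cong (positionsFrom 1 (s + w)) (merge-swap σ a b′) ⟩
    positionsFrom 1 (s + w) (merge (map not σ) b′ a)
      ≡⟨ positionsFrom-merge (map not σ) b′ a 1 (s + w) (Mask-not mask′) avoid ⟩
    map (nth (select (map not σ) (range 1 (length (map not σ))))) (positionsFrom 1 (s + w) b′)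
      ≡⟨ cong (λ n → map (nth (select (map not σ) (range 1 n))) (positionsFrom 1 (s + w) b′)) (length-map not σ) ⟩
    map (nth (select (map not σ) L)) (positionsFrom 1 (s + w) b′)
      ≡⟨ cong (map _) (positionsFrom-map (s +_) 1 (s + w) w (All.universal (λ x → ≡ᵇ-+ s x w) b)) ⟩
    map (nth (select (map not σ) L)) (positionsFrom 1 w b) ∎
    where
    open ≡-Reasoning
    avoid : All (λ y → (y ≡ᵇ s + w) ≡ false) a
    avoid = All.map (λ (_ , y≤s) → ≡ᵇ-false (<⇒≢ (≤-<-trans y≤s (m<m+n s 1≤w)))) (parkingWord-letters a a-pw)

  toPF-merge : let I = interval (length a + length b) in
               relabel (select σ I) (toPF a) ++ relabel (complementIn (length a + length b) (select σ I)) (toPF b)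
               ≡ toPF (merge σ a (map (length a +_) b))
  toPF-merge = begin
    relabel (select σ I) (toPF a) ++ relabel (complementIn (s + t) (select σ I)) (toPF b)
      ≡⟨ cong (λ J → relabel (select σ J) (toPF a) ++ relabel (filterᵇ (λ x → not (elemℕ x (select σ J))) J) (toPF b)) I≡L ⟩
    relabel (select σ L) (toPF a) ++ relabel (filterᵇ (λ x → not (elemℕ x (select σ L))) L) (toPF b)
      ≡⟨ cong (λ S → relabel (select σ L) (toPF a) ++ relabel S (toPF b)) (complement-select 1 σ) ⟩
    relabel (select σ L) (toPF a) ++ relabel (select (map not σ) L) (toPF b)
      ≡⟨ cong₂ _++_
           (trans (sym (map-∘ (range 1 s)))
                  (map-cong-local (All.map (λ (_ , v<) → sym (positionsFrom-merge-left (s≤s⁻¹ v<))) (range-bounds 1 s))))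
           (trans (sym (map-∘ (range 1 t)))
                  (map-cong-local (All.map (λ (1≤w , _) → sym (positionsFrom-merge-right 1≤w)) (range-bounds 1 t)))) ⟩
    map block (range 1 s) ++ map (block ∘ (s +_)) (range 1 t)
      ≡⟨ cong (map block (range 1 s) ++_) (trans (map-∘ (range 1 t)) (cong (map block) (map-+-range s 1 t))) ⟩
    map block (range 1 s) ++ map block (range (s + 1) t)
      ≡⟨ map-++ block (range 1 s) _ ⟨
    map block (range 1 s ++ range (s + 1) t)
      ≡⟨ cong (map block) (trans (cong (λ k → range 1 s ++ range k t) (+-comm s 1)) (range-++ 1 s t)) ⟩
    map block (range 1 (s + t))
      ≡⟨ cong (λ n → map block (range 1 n)) length-c ⟨
    toPF c ∎
    where
    open ≡-Reasoning
    I = interval (s + t)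
    I≡L : I ≡ L
    I≡L = trans (interval≡range (s + t)) (cong (range 1) (sym (Mask-length mask)))
    block : ℕ → List ℕ
    block v = positionsFrom 1 v c

-- park and Park

searchD-spec : ∀ f i u → length u < i + f →
               let d = searchD f i u in i ≤ d × count≤ d u < d × (∀ j → i ≤ j → j < d → j ≤ count≤ j u)
searchD-spec zero    i u ∣u∣< =
  ≤-refl , ≤-<-trans (count-≤-length _ u) (subst (length u <_) (+-identityʳ i) ∣u∣<) , λ j i≤j j<i → ⊥-elim (<⇒≱ j<i i≤j)
searchD-spec (suc f) i u ∣u∣< with count≤ i u <ᵇ i in deficient
... | true  = ≤-refl , <ᵇ⇒< _ _ (≡true⇒T deficient) , λ j i≤j j<i → ⊥-elim (<⇒≱ j<i i≤j)
... | false with searchD-spec f (suc i) u (subst (length u <_) (+-suc i f) ∣u∣<)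
...   | i<d , d-deficient , below = <⇒≤ i<d , d-deficient , below′
  where
  below′ : ∀ j → i ≤ j → j < searchD f (suc i) u → j ≤ count≤ j u
  below′ j i≤j j<d with i ≟ j
  ... | yes refl = ≮⇒≥ (λ c<i → subst T deficient (<⇒<ᵇ c<i))
  ... | no  i≢j  = below j (≤∧≢⇒< i≤j i≢j) j<d

record LeastDeficiency (u : List ℕ) (d : ℕ) : Set where
  field
    1≤d       : 1 ≤ d
    deficient : count≤ d u < d
    least     : ∀ j → 1 ≤ j → j < d → j ≤ count≤ j u

dPark-spec : ∀ u → LeastDeficiency u (dPark u)
dPark-spec u with searchD-spec (suc (length u)) 1 u (s≤s (n≤1+n (length u)))
... | 1≤d , deficient , least = record { 1≤d = 1≤d ; deficient = deficient ; least = least }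

parkC-keeps : ∀ j N u R → (∀ i → j < i → i ≤ j + N → i ≤ count≤ i u) →
              parkC (count≤ j u) j (blocks u (range (suc j) N) ++ R)
              ≡ blocks u (range (suc j) N) ++ parkC (count≤ (j + N) u) (j + N) R
parkC-keeps j zero    u R enough rewrite +-identityʳ j = refl
parkC-keeps j (suc N) u R enough
  rewrite length-positionsFrom 1 (suc j) u | sym (count≤-suc j u)
        | ≤ᵇ-true (enough (suc j) ≤-refl (subst (suc j ≤_) (sym (+-suc j N)) (s≤s (m≤m+n j N))))
        | +-suc j N =
  cong (positionsFrom 1 (suc j) u ∷_) (parkC-keeps (suc j) N u R (λ i j<i → enough i (<-trans (n<1+n j) j<i)))

parkC-drop-empty : ∀ s R → parkC s s ([] ∷ R) ≡ parkC s s R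
parkC-drop-empty s R rewrite +-identityʳ s | ≤ᵇ-false (≤-refl {suc s}) = refl

parkC-drops-empties : ∀ s {R} → All (_≡ []) R → parkC s s R ≡ []
parkC-drops-empties s []           = refl
parkC-drops-empties s {_ ∷ R} (refl ∷ R≡[]) = trans (parkC-drop-empty s R) (parkC-drops-empties s R≡[])

parkC-map : ∀ (f : ℕ → ℕ) s l Ψ → parkC s l (map (map f) Ψ) ≡ map (map f) (parkC s l Ψ)
parkC-map f s l []      = refl
parkC-map f s l (B ∷ Ψ) rewrite length-map f B with suc l ≤ᵇ s + length B
... | true  = cong (map f B ∷_) (parkC-map f (s + length B) (suc l) Ψ)
... | false = parkC-map f s l Ψ

park-blocks-parkingWord : ∀ u m → T (isParkingWord u) → length u ≤ m → park (blocks u (range 1 m)) ≡ toPF u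
park-blocks-parkingWord u m u-pw ∣u∣≤m = begin
  parkC 0 0 (blocks u (range 1 m))
    ≡⟨ cong₂ (λ s → parkC s 0) (sym (count≤-0 (isParkingWord⇒positive u u-pw))) split ⟩
  parkC (count≤ 0 u) 0 (toPF u ++ blocks u (range (suc n) (m ∸ n)))
    ≡⟨ parkC-keeps 0 n u _ (λ i → isParkingWord⇒counts u u-pw i) ⟩
  toPF u ++ parkC (count≤ n u) n (blocks u (range (suc n) (m ∸ n)))
    ≡⟨ cong (λ s → toPF u ++ parkC s n (blocks u (range (suc n) (m ∸ n)))) all-letters ⟩
  toPF u ++ parkC n n (blocks u (range (suc n) (m ∸ n)))
    ≡⟨ cong (toPF u ++_) (parkC-drops-empties n (All.map⁺ (All.map (λ (n<v , _) → positionsFrom-none 1 _ (avoid n<v))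
                                                                   (range-bounds (suc n) (m ∸ n))))) ⟩
  toPF u ++ []
    ≡⟨ ++-identityʳ _ ⟩
  toPF u ∎
  where
  open ≡-Reasoning
  n = length u
  split : blocks u (range 1 m) ≡ toPF u ++ blocks u (range (suc n) (m ∸ n))
  split = trans (cong (λ k → blocks u (range 1 k)) (sym (m+[n∸m]≡n ∣u∣≤m)))
                (trans (cong (blocks u) (sym (range-++ 1 n (m ∸ n)))) (map-++ _ (range 1 n) _))
  all-letters : count≤ n u ≡ n
  all-letters = count-all _ (All.map (λ (_ , x≤n) → ≤ᵇ-true x≤n) (parkingWord-letters u u-pw))
  avoid : ∀ {v} → n < v → All (λ x → (x ≡ᵇ v) ≡ false) u
  avoid n<v = All.map (λ (_ , x≤n) → ≡ᵇ-false (<⇒≢ (≤-<-trans x≤n n<v))) (parkingWord-letters u u-pw)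

-- parkStep u is map (decrementAbove (dPark u)) u by definition.
decrementAbove : ℕ → ℕ → ℕ
decrementAbove d x = if d <ᵇ x then x ∸ 1 else x

decrementAbove-≤ : ∀ {d x} → x ≤ d → decrementAbove d x ≡ x
decrementAbove-≤ x≤d rewrite <ᵇ-false x≤d = refl

decrementAbove-> : ∀ {d x} → d < x → suc (decrementAbove d x) ≡ x
decrementAbove-> {x = suc x} d<x rewrite <ᵇ-true d<x = refl

decrementAbove-< : ∀ {d x} → d < x → decrementAbove d x < x
decrementAbove-< {d} {x} d<x = ≤-reflexive (decrementAbove-> {d} {x} d<x)

≤-decrementAbove : ∀ {d x} → d < x → d ≤ decrementAbove d x
≤-decrementAbove {d} {x} d<x = s≤s⁻¹ (subst (d <_) (sym (decrementAbove-> {d} {x} d<x)) d<x)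

decrementAbove-≡ᵇ-below : ∀ d x v → v < d → (decrementAbove d x ≡ᵇ v) ≡ (x ≡ᵇ v)
decrementAbove-≡ᵇ-below d x v v<d with x ≤? d
... | yes x≤d rewrite decrementAbove-≤ x≤d = refl
... | no  x≰d = trans (≡ᵇ-false (>⇒≢ v<x-1)) (sym (≡ᵇ-false (>⇒≢ (<-trans v<x-1 (decrementAbove-< {d} {x} (≰⇒> x≰d))))))
  where
  v<x-1 : v < decrementAbove d x
  v<x-1 = <-≤-trans v<d (≤-decrementAbove {d} {x} (≰⇒> x≰d))

decrementAbove-≡ᵇ-above : ∀ d x v → d ≤ v → x ≢ d → (decrementAbove d x ≡ᵇ v) ≡ (x ≡ᵇ suc v)
decrementAbove-≡ᵇ-above d x v d≤v x≢d with x ≤? d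
... | yes x≤d rewrite decrementAbove-≤ x≤d =
  trans (≡ᵇ-false (<⇒≢ x<v)) (sym (≡ᵇ-false (<⇒≢ (<-trans x<v (n<1+n v)))))
  where
  x<v : x < v
  x<v = <-≤-trans (≤∧≢⇒< x≤d x≢d) d≤v
... | no  x≰d = cong (_≡ᵇ suc v) (decrementAbove-> {d} {x} (≰⇒> x≰d))

decrementAbove-≤ᵇ-below : ∀ d x j → j < d → (decrementAbove d x ≤ᵇ j) ≡ (x ≤ᵇ j)
decrementAbove-≤ᵇ-below d x j j<d with x ≤? d
... | yes x≤d rewrite decrementAbove-≤ x≤d = refl
... | no  x≰d = trans (≤ᵇ-false (<-≤-trans j<d (≤-decrementAbove {d} {x} (≰⇒> x≰d))))
                      (sym (≤ᵇ-false (<-trans j<d (≰⇒> x≰d))))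

decrementAbove-≤ᵇ-above : ∀ d x j → d ≤ j → x ≢ d → (decrementAbove d x ≤ᵇ j) ≡ (x ≤ᵇ suc j)
decrementAbove-≤ᵇ-above d x j d≤j x≢d with x ≤? d
... | yes x≤d rewrite decrementAbove-≤ x≤d =
  trans (≤ᵇ-true x≤j) (sym (≤ᵇ-true (≤-trans x≤j (n≤1+n j))))
  where
  x≤j : x ≤ j
  x≤j = ≤-trans x≤d d≤j
... | no  x≰d = trans (≤ᵇ-cong-⇔ {decrementAbove d x} {j} s≤s s≤s⁻¹)
                      (cong (_≤ᵇ suc j) (decrementAbove-> {d} {x} (≰⇒> x≰d)))

decrementAbove-positive : ∀ {d x} → 1 ≤ d → 1 ≤ x → 1 ≤ decrementAbove d x
decrementAbove-positive {d} {x} 1≤d 1≤x with x ≤? d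
... | yes x≤d rewrite decrementAbove-≤ x≤d = 1≤x
... | no  x≰d = ≤-trans 1≤d (≤-decrementAbove {d} {x} (≰⇒> x≰d))

decrementAbove-+ : ∀ d x → decrementAbove d x + indicator (d <ᵇ x) ≡ x
decrementAbove-+ d x with x ≤? d
... | yes x≤d rewrite decrementAbove-≤ x≤d | <ᵇ-false x≤d = +-identityʳ x
... | no  x≰d = trans (cong (λ b → decrementAbove d x + indicator b) (<ᵇ-true (≰⇒> x≰d)))
                      (trans (+-comm _ 1) (decrementAbove-> {d} {x} (≰⇒> x≰d)))

sum-decrementAbove : ∀ d u → sum (map (decrementAbove d) u) + count (d <ᵇ_) u ≡ sum u
sum-decrementAbove d []      = refl
sum-decrementAbove d (x ∷ u) =
  trans (cong (decrementAbove d x + sum (map (decrementAbove d) u) +_) (count-∷ (d <ᵇ_) x u))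
        (trans (interchange (decrementAbove d x) _ (indicator (d <ᵇ x)) _)
               (cong₂ _+_ (decrementAbove-+ d x) (sum-decrementAbove d u)))

count-<ᵇ+count≤ : ∀ d u → count (d <ᵇ_) u + count≤ d u ≡ length u
count-<ᵇ+count≤ d []      = refl
count-<ᵇ+count≤ d (x ∷ u) =
  trans (cong₂ _+_ (count-∷ (d <ᵇ_) x u) (count-∷ (_≤ᵇ d) x u))
        (trans (interchange (indicator (d <ᵇ x)) _ (indicator (x ≤ᵇ d)) _)
               (cong₂ _+_ (one-of d x) (count-<ᵇ+count≤ d u)))
  where
  one-of : ∀ d x → indicator (d <ᵇ x) + indicator (x ≤ᵇ d) ≡ 1
  one-of d x with x ≤? d
  ... | yes x≤d rewrite <ᵇ-false x≤d | ≤ᵇ-true x≤d = refl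
  ... | no  x≰d rewrite <ᵇ-true (≰⇒> x≰d) | ≤ᵇ-false (≰⇒> x≰d) = refl

least-deficiency-full : ∀ {u e} → LeastDeficiency u (suc e) → ∀ j → j ≤ e → j ≤ count≤ j u
least-deficiency-full ld zero    _   = z≤n
least-deficiency-full ld (suc j) j<e = LeastDeficiency.least ld (suc j) (s≤s z≤n) (s≤s j<e)

least-deficiency-gap : ∀ {u e} → LeastDeficiency u (suc e) → count≤ e u ≡ e × All (_≢ suc e) u
least-deficiency-gap {u} {e} ld = e-full , All.map (λ x≢ᵇ x≡ → subst T x≢ᵇ (≡⇒≡ᵇ _ _ x≡)) (count≡0⇒none _ u gap)
  where
  sum≤e : count≤ e u + count (_≡ᵇ suc e) u ≤ e
  sum≤e = s≤s⁻¹ (subst (_< suc e) (count≤-suc e u) (LeastDeficiency.deficient ld))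
  e-full : count≤ e u ≡ e
  e-full = ≤-antisym (≤-trans (m≤m+n _ _) sum≤e) (least-deficiency-full ld e ≤-refl)
  gap : count (_≡ᵇ suc e) u ≡ 0
  gap = n≤0⇒n≡0 (+-cancelˡ-≤ (count≤ e u) _ 0 (≤-trans sum≤e (≤-reflexive (sym (trans (+-identityʳ _) e-full)))))

-- Invariant of the Park iteration on a subword u of a parking word of length m;
-- each Park step lowers m by one.
record Parkable (u : List ℕ) (m : ℕ) : Set where
  field
    positive : All (1 ≤_) u
    short    : length u ≤ m
    enough   : ∀ j → j ≤ m → j ≤ count≤ j u + (m ∸ length u)

Parkable-part : ∀ a u w → T (isParkingWord a) → u ++ w ↭ a → Parkable u (length a)
Parkable-part a u w a-pw u++w↭a = record { positive = positive ; short = short ; enough = enough }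
  where
  ∣u∣+∣w∣ : length u + length w ≡ length a
  ∣u∣+∣w∣ = trans (sym (length-++ u)) (↭-length u++w↭a)
  positive : All (1 ≤_) u
  positive = All.++⁻ˡ u (All-resp-↭ (↭-sym u++w↭a) (isParkingWord⇒positive a a-pw))
  short : length u ≤ length a
  short = subst (length u ≤_) ∣u∣+∣w∣ (m≤m+n _ _)
  enough : ∀ j → j ≤ length a → j ≤ count≤ j u + (length a ∸ length u)
  enough zero    _     = z≤n
  enough (suc j) j<∣a∣ = begin
    suc j                            ≤⟨ isParkingWord⇒counts a a-pw (suc j) (s≤s z≤n) j<∣a∣ ⟩
    count≤ (suc j) a                 ≡⟨ trans (count-↭ _ (↭-sym u++w↭a)) (count-++ _ u w) ⟩
    count≤ (suc j) u + count≤ (suc j) w ≤⟨ +-monoʳ-≤ _ (count-≤-length _ w) ⟩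
    count≤ (suc j) u + length w      ≡⟨ cong (count≤ (suc j) u +_) ∣a∣-∣u∣ ⟨
    count≤ (suc j) u + (length a ∸ length u) ∎
    where
    open ≤-Reasoning
    ∣a∣-∣u∣ : length a ∸ length u ≡ length w
    ∣a∣-∣u∣ = trans (cong (_∸ length u) (sym ∣u∣+∣w∣)) (m+n∸m≡n (length u) (length w))

blocks-gap : ∀ {u e} m → LeastDeficiency u (suc e) → e ≤ m →
             blocks u (range 1 (suc m)) ≡ blocks u (range 1 e) ++ [] ∷ blocks u (range (suc (suc e)) (m ∸ e))
blocks-gap {u} {e} m ld e≤m = begin
  blocks u (range 1 (suc m))
    ≡⟨ cong (λ k → blocks u (range 1 k)) (sym (trans (+-suc e (m ∸ e)) (cong suc (m+[n∸m]≡n e≤m)))) ⟩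
  blocks u (range 1 (e + suc (m ∸ e)))
    ≡⟨ cong (blocks u) (range-++ 1 e (suc (m ∸ e))) ⟨
  blocks u (range 1 e ++ range (suc e) (suc (m ∸ e)))
    ≡⟨ map-++ _ (range 1 e) _ ⟩
  blocks u (range 1 e) ++ positionsFrom 1 (suc e) u ∷ blocks u (range (suc (suc e)) (m ∸ e))
    ≡⟨ cong (λ B → blocks u (range 1 e) ++ B ∷ blocks u (range (suc (suc e)) (m ∸ e)))
            (positionsFrom-none 1 (suc e) (All.map ≡ᵇ-false (proj₂ (least-deficiency-gap ld)))) ⟩
  blocks u (range 1 e) ++ [] ∷ blocks u (range (suc (suc e)) (m ∸ e)) ∎
  where open ≡-Reasoning

blocks-decrementAbove : ∀ {u e} m → LeastDeficiency u (suc e) → e ≤ m →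
                        blocks (map (decrementAbove (suc e)) u) (range 1 m)
                        ≡ blocks u (range 1 e) ++ blocks u (range (suc (suc e)) (m ∸ e))
blocks-decrementAbove {u} {e} m ld e≤m = begin
  blocks u′ (range 1 m)                                ≡⟨ cong (λ k → blocks u′ (range 1 k)) (sym (m+[n∸m]≡n e≤m)) ⟩
  blocks u′ (range 1 (e + N))                          ≡⟨ cong (blocks u′) (range-++ 1 e N) ⟨
  blocks u′ (range 1 e ++ range d N)                   ≡⟨ map-++ _ (range 1 e) _ ⟩
  blocks u′ (range 1 e) ++ blocks u′ (range d N)       ≡⟨ cong₂ _++_ below above ⟩
  blocks u (range 1 e) ++ blocks u (map suc (range d N)) ≡⟨ cong (λ vs → blocks u (range 1 e) ++ blocks u vs) (map-+-range 1 d N) ⟩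
  blocks u (range 1 e) ++ blocks u (range (suc d) N)   ∎
  where
  open ≡-Reasoning
  d  = suc e
  u′ = map (decrementAbove d) u
  N  = m ∸ e
  below : blocks u′ (range 1 e) ≡ blocks u (range 1 e)
  below = map-cong-local (All.map (λ {v} (_ , v<d) → positionsFrom-map _ 1 v v
                                                        (All.universal (λ x → decrementAbove-≡ᵇ-below d x v v<d) u))
                                  (range-bounds 1 e))
  above : blocks u′ (range d N) ≡ blocks u (map suc (range d N))
  above = trans (map-cong-local (All.map (λ {v} (d≤v , _) → positionsFrom-map _ 1 v (suc v)
                                                               (All.map (decrementAbove-≡ᵇ-above d _ v d≤v) (proj₂ (least-deficiency-gap ld))))
                                         (range-bounds d N)))
                (map-∘ (range d N))

-- Both sides keep the first e full blocks; then park drops the empty block d, which decrementing removes.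
park-blocks-decrement : ∀ {u e m} → All (1 ≤_) u → LeastDeficiency u (suc e) → e ≤ m →
                        park (blocks u (range 1 (suc m))) ≡ park (blocks (map (decrementAbove (suc e)) u) (range 1 m))
park-blocks-decrement {u} {e} {m} positive ld e≤m = begin
  park (blocks u (range 1 (suc m)))                      ≡⟨ cong park (blocks-gap m ld e≤m) ⟩
  park (P ++ [] ∷ R)                                     ≡⟨ keep ([] ∷ R) ⟩
  P ++ parkC e e ([] ∷ R)                                ≡⟨ cong (P ++_) (parkC-drop-empty e R) ⟩
  P ++ parkC e e R                                       ≡⟨ keep R ⟨
  park (P ++ R)                                          ≡⟨ cong park (blocks-decrementAbove m ld e≤m) ⟨
  park (blocks (map (decrementAbove (suc e)) u) (range 1 m)) ∎
  where
  open ≡-Reasoning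
  P = blocks u (range 1 e)
  R = blocks u (range (suc (suc e)) (m ∸ e))
  keep : ∀ X → park (P ++ X) ≡ P ++ parkC e e X
  keep X = trans (cong (λ s → parkC s 0 (P ++ X)) (sym (count≤-0 positive)))
                 (trans (parkC-keeps 0 e u X (λ i _ i≤e → least-deficiency-full ld i i≤e))
                        (cong (λ s → P ++ parkC s e X) (proj₁ (least-deficiency-gap ld))))

decrement-Parkable : ∀ {u e m} → Parkable u (suc m) → LeastDeficiency u (suc e) → length u ≤ m →
                     Parkable (map (decrementAbove (suc e)) u) m
decrement-Parkable {u} {e} {m} p ld ∣u∣≤m = record
  { positive = All.map⁺ (All.map (decrementAbove-positive (s≤s z≤n)) (Parkable.positive p))
  ; short    = subst (_≤ m) (sym (length-map _ u)) ∣u∣≤m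
  ; enough   = enough
  }
  where
  d  = suc e
  u′ = map (decrementAbove d) u
  enough : ∀ j → j ≤ m → j ≤ count≤ j u′ + (m ∸ length u′)
  enough j j≤m rewrite length-map (decrementAbove d) u with j ≤? e
  ... | yes j≤e = begin
    j                           ≤⟨ least-deficiency-full ld j j≤e ⟩
    count≤ j u                  ≡⟨ count-map (_≤ᵇ j) (_≤ᵇ j) (decrementAbove d)
                                     (All.universal (λ x → decrementAbove-≤ᵇ-below d x j (s≤s j≤e)) u) ⟨
    count≤ j u′                 ≤⟨ m≤m+n _ _ ⟩
    count≤ j u′ + (m ∸ length u) ∎
    where open ≤-Reasoning
  ... | no  j≰e = begin
    j                                  ≤⟨ s≤s⁻¹ (subst (suc j ≤_) (trans (cong (count≤ (suc j) u +_) (+-∸-assoc 1 ∣u∣≤m)) (+-suc _ _))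
                                                  (Parkable.enough p (suc j) (s≤s j≤m))) ⟩
    count≤ (suc j) u + (m ∸ length u)  ≡⟨ cong (_+ (m ∸ length u)) (count-map (_≤ᵇ j) (_≤ᵇ suc j) (decrementAbove d)
                                            (All.map (decrementAbove-≤ᵇ-above d _ j (≰⇒> j≰e)) (proj₂ (least-deficiency-gap ld)))) ⟨
    count≤ j u′ + (m ∸ length u)       ∎
    where open ≤-Reasoning

sum-decrementAbove-< : ∀ {u d} → LeastDeficiency u d → d ≤ length u → sum (map (decrementAbove d) u) < sum u
sum-decrementAbove-< {u} {d} ld d≤∣u∣ =
  subst (sum (map (decrementAbove d) u) <_) (sum-decrementAbove d u) (m<m+n _ some-above)
  where
  some-above : 1 ≤ count (d <ᵇ_) u
  some-above with count (d <ᵇ_) u | count-<ᵇ+count≤ d u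
  ... | zero  | none-above = ⊥-elim (<⇒≱ (LeastDeficiency.deficient ld) (subst (d ≤_) (sym none-above) d≤∣u∣))
  ... | suc _ | _          = s≤s z≤n

non-parking-bounds : ∀ {u m d} → Parkable u m → LeastDeficiency u d → ¬ T (isParkingWord u) →
                     d ≤ length u × length u < m
non-parking-bounds {u} {m} {d} p ld non-pw = d≤∣u∣ , ∣u∣<m
  where
  open Parkable p
  d≤∣u∣ : d ≤ length u
  d≤∣u∣ with d ≤? length u
  ... | yes d≤∣u∣ = d≤∣u∣
  ... | no  d≰∣u∣ = contradiction (isParkingWord-intro positive counts) non-pw
    where
    counts : HasParkingCounts u
    counts j 1≤j j≤∣u∣ = LeastDeficiency.least ld j 1≤j (≤-<-trans j≤∣u∣ (≰⇒> d≰∣u∣))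
  ∣u∣<m : length u < m
  ∣u∣<m with length u <? m
  ... | yes ∣u∣<m = ∣u∣<m
  ... | no  ∣u∣≮m = contradiction (isParkingWord-intro positive counts) non-pw
    where
    counts : HasParkingCounts u
    counts j _ j≤∣u∣ = subst (j ≤_) (trans (cong (count≤ j u +_) (m≤n⇒m∸n≡0 (≮⇒≥ ∣u∣≮m))) (+-identityʳ _))
                              (enough j (≤-trans j≤∣u∣ short))

park-blocks-parkStep : ∀ {u m d} → Parkable u m → LeastDeficiency u d → d ≤ length u → length u < m →
                       park (blocks u (range 1 m)) ≡ park (blocks (map (decrementAbove d) u) (range 1 (m ∸ 1)))
                       × Parkable (map (decrementAbove d) u) (m ∸ 1)
park-blocks-parkStep {u} {suc m} {suc e} p ld d≤∣u∣ ∣u∣<m =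
  park-blocks-decrement (Parkable.positive p) ld (<⇒≤ (≤-trans d≤∣u∣ ∣u∣≤m)) , decrement-Parkable p ld ∣u∣≤m
  where
  ∣u∣≤m : length u ≤ m
  ∣u∣≤m = s≤s⁻¹ ∣u∣<m
park-blocks-parkStep {d = zero} p ld = ⊥-elim (<⇒≱ (LeastDeficiency.1≤d ld) z≤n)

park-blocks-Park : ∀ f u m → sum u < f → Parkable u m →
                   park (blocks u (range 1 m)) ≡ toPF (parkWordF f u) × T (isParkingWord (parkWordF f u))
park-blocks-Park (suc f) u m sum<f p with isParkingWord u in u-pw
... | true  = park-blocks-parkingWord u m (≡true⇒T u-pw) (Parkable.short p) , ≡true⇒T u-pw
... | false = trans (proj₁ step) (proj₁ rest) , proj₂ rest
  where
  ld : LeastDeficiency u (dPark u)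
  ld = dPark-spec u
  bounds : dPark u ≤ length u × length u < m
  bounds = non-parking-bounds p ld (subst T u-pw)
  step : park (blocks u (range 1 m)) ≡ park (blocks (parkStep u) (range 1 (m ∸ 1))) × Parkable (parkStep u) (m ∸ 1)
  step = park-blocks-parkStep p ld (proj₁ bounds) (proj₂ bounds)
  rest : park (blocks (parkStep u) (range 1 (m ∸ 1))) ≡ toPF (parkWordF f (parkStep u))
         × T (isParkingWord (parkWordF f (parkStep u)))
  rest = park-blocks-Park f (parkStep u) (m ∸ 1)
           (<-≤-trans (sum-decrementAbove-< ld (proj₁ bounds)) (s≤s⁻¹ sum<f)) (proj₂ step)

filter-positions-≤ : ∀ k i v a → filterᵇ (_≤ᵇ k + i) (positionsFrom (suc k) v a) ≡ positionsFrom (suc k) v (take i a)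
filter-positions-≤ k zero    v a       =
  filterᵇ-none _ (All.map (λ k<x → ≤ᵇ-false (subst (_< _) (sym (+-identityʳ k)) k<x)) (positionsFrom-≥ (suc k) v a))
filter-positions-≤ k (suc i) v []      = refl
filter-positions-≤ k (suc i) v (x ∷ a) with x ≡ᵇ v
... | true  rewrite ≤ᵇ-true (m<m+n k {suc i} z<s) | +-suc k i = cong (suc k ∷_) (filter-positions-≤ (suc k) i v a)
... | false rewrite +-suc k i = filter-positions-≤ (suc k) i v a

filter-positions-> : ∀ k i v a → filterᵇ (k + i <ᵇ_) (positionsFrom (suc k) v a) ≡ positionsFrom (suc k + i) v (drop i a)
filter-positions-> k zero    v a       rewrite +-identityʳ k =
  filter-all (T? ∘ (k <ᵇ_)) (All.map <⇒<ᵇ (positionsFrom-≥ (suc k) v a))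
filter-positions-> k (suc i) v []      = refl
filter-positions-> k (suc i) v (x ∷ a) with x ≡ᵇ v
... | true  rewrite <ᵇ-false (m<m+n k {suc i} z<s) | +-suc k i = filter-positions-> (suc k) i v a
... | false rewrite +-suc k i = filter-positions-> (suc k) i v a

restrictLow-toPF : ∀ i a → restrictLow i (toPF a) ≡ blocks (take i a) (range 1 (length a))
restrictLow-toPF i a = trans (sym (map-∘ _)) (map-cong (λ v → filter-positions-≤ 0 i v a) _)

restrictHigh-toPF : ∀ i a → restrictHigh i (toPF a) ≡ map (map (i +_)) (blocks (drop i a) (range 1 (length a)))
restrictHigh-toPF i a = trans (sym (map-∘ _)) (trans (map-cong shifted _) (map-∘ _))
  where
  shifted : ∀ v → filterᵇ (i <ᵇ_) (positionsFrom 1 v a) ≡ map (i +_) (positionsFrom 1 v (drop i a))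
  shifted v = trans (filter-positions-> 0 i v a)
                    (trans (cong (λ k → positionsFrom k v (drop i a)) (+-comm 1 i)) (positionsFrom-+ i 1 v (drop i a)))

park-restrictLow-toPF : ∀ a i → T (isParkingWord a) →
                        park (restrictLow i (toPF a)) ≡ toPF (Park (take i a)) × T (isParkingWord (Park (take i a)))
park-restrictLow-toPF a i a-pw =
  map₁ (trans (cong park (restrictLow-toPF i a)))
       (park-blocks-Park _ (take i a) (length a) ≤-refl (Parkable-part a _ (drop i a) a-pw (↭-reflexive (take++drop≡id i a))))

park-restrictHigh-toPF : ∀ a i → T (isParkingWord a) →
                         shiftDown i (park (restrictHigh i (toPF a))) ≡ toPF (Park (drop i a)) × T (isParkingWord (Park (drop i a)))
park-restrictHigh-toPF a i a-pw =
  map₁ (trans (begin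
    shiftDown i (park (restrictHigh i (toPF a)))  ≡⟨ cong (shiftDown i ∘ park) (restrictHigh-toPF i a) ⟩
    shiftDown i (park (map (map (i +_)) X))      ≡⟨ cong (shiftDown i) (parkC-map (i +_) 0 0 X) ⟩
    shiftDown i (map (map (i +_)) (park X))      ≡⟨ shiftDown-shift (park X) ⟩
    park X                                       ∎))
       (park-blocks-Park _ (drop i a) (length a) ≤-refl
          (Parkable-part a (drop i a) (take i a) a-pw (↭-trans (++-comm (drop i a) (take i a)) (↭-reflexive (take++drop≡id i a)))))
  where
  open ≡-Reasoning
  X = blocks (drop i a) (range 1 (length a))
  shiftDown-shift : ∀ Ψ → shiftDown i (map (map (i +_)) Ψ) ≡ Ψ
  shiftDown-shift Ψ = trans (sym (map-∘ Ψ)) (map-id-local (All.universal unshift Ψ))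
    where
    unshift : ∀ B → map (_∸ i) (map (i +_) B) ≡ B
    unshift B = trans (sym (map-∘ B)) (map-id-local (All.universal (m+n∸m≡n i) B))

-- Based bialgebras

module _ {c ℓ} (K : Field c ℓ) where
  open Field K using (Carrier; _≈_; 1#)
    renaming (_+_ to _+ᴷ_; _*_ to _*ᴷ_; +-cong to +ᴷ-cong; *-cong to *ᴷ-cong; *-identityʳ to *ᴷ-identityʳ;
              setoid to K-setoid; refl to ≈-refl; trans to ≈-trans)
  open FreeModule K

  -- Termwise equality of formal sums: it implies Eq, and extend and extend₂ preserve it.
  ≋-setoid : Set → Setoid c (c ⊔ ℓ)
  ≋-setoid B = Pointwise.setoid (×-setoid K-setoid (setoid B))

  _≋_ : {B : Set} → Lin B → Lin B → Set (c ⊔ ℓ)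
  _≋_ {B} = Setoid._≈_ (≋-setoid B)

  ≋⇒Eq : {B : Set} (_≟_ : DecidableEquality B) {v w : Lin B} → v ≋ w → Eq _≟_ v w
  ≋⇒Eq _≟_ []                                  b = ≈-refl
  ≋⇒Eq _≟_ {(_ , b′) ∷ _} ((x≈y , refl) ∷ rest) b with does (b′ ≟ b)
  ... | true  = +ᴷ-cong x≈y (≋⇒Eq _≟_ rest b)
  ... | false = ≋⇒Eq _≟_ rest b

  scale-≋ : {B : Set} {x y : Carrier} {v w : Lin B} → x ≈ y → v ≋ w → scale x v ≋ scale y w
  scale-≋ x≈y []                 = []
  scale-≋ x≈y ((e , refl) ∷ rest) = (*ᴷ-cong x≈y e , refl) ∷ scale-≋ x≈y rest

  extend-≋ : {A B : Set} (m : A → Lin B) {v w : Lin A} → v ≋ w → extend m v ≋ extend m w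
  extend-≋ m []                                  = []
  extend-≋ m {(_ , a) ∷ _} ((x≈y , refl) ∷ rest) =
    Pointwise.++⁺ (scale-≋ x≈y (Setoid.refl (≋-setoid _))) (extend-≋ m rest)

  extend₂-≋ : {A A′ B : Set} (m : A → A′ → Lin B) {v v′ : Lin A} {w w′ : Lin A′} →
              v ≋ v′ → w ≋ w′ → extend₂ m v w ≋ extend₂ m v′ w′
  extend₂-≋ m []                                     _     = []
  extend₂-≋ m {(x , a) ∷ _} {(x′ , _) ∷ _} ((x≈x′ , refl) ∷ rest) w≋w′ =
    Pointwise.++⁺ (row w≋w′) (extend₂-≋ m rest w≋w′)
    where
    row : ∀ {w w′} → w ≋ w′ → concatMap (λ q → scale (x *ᴷ proj₁ q) (m a (proj₂ q))) w
                              ≋ concatMap (λ q → scale (x′ *ᴷ proj₁ q) (m a (proj₂ q))) w′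
    row []                                    = []
    row {(_ , a′) ∷ _} ((y≈y′ , refl) ∷ rest′) =
      Pointwise.++⁺ (scale-≋ (*ᴷ-cong x≈x′ y≈y′) (Setoid.refl (≋-setoid _))) (row rest′)

  mapBasis : {A B : Set} → (A → B) → Lin A → Lin B
  mapBasis g = map (map₂ g)

  mapBasis-scale : {A B : Set} (g : A → B) (x : Carrier) (v : Lin A) → mapBasis g (scale x v) ≡ scale x (mapBasis g v)
  mapBasis-scale g x []      = refl
  mapBasis-scale g x (_ ∷ v) = cong (_ ∷_) (mapBasis-scale g x v)

  mapBasis-extend : {A B C : Set} (g : B → C) (m : A → Lin B) (v : Lin A) → mapBasis g (extend m v) ≡ extend (mapBasis g ∘ m) v
  mapBasis-extend g m v = trans (map-concatMap _ _ v) (concatMap-cong (λ (x , a) → mapBasis-scale g x (m a)) v)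

  mapBasis-extend₂ : {A A′ B C : Set} (g : B → C) (m : A → A′ → Lin B) (v : Lin A) (w : Lin A′) →
                     mapBasis g (extend₂ m v w) ≡ extend₂ (λ a a′ → mapBasis g (m a a′)) v w
  mapBasis-extend₂ g m v w =
    trans (map-concatMap _ _ v) (concatMap-cong (λ p → trans (map-concatMap _ _ w)
      (concatMap-cong (λ q → mapBasis-scale g (proj₁ p *ᴷ proj₁ q) (m (proj₂ p) (proj₂ q))) w)) v)

  extend-mapBasis : {A B C : Set} (m : B → Lin C) (g : A → B) (v : Lin A) → extend m (mapBasis g v) ≡ extend (m ∘ g) v
  extend-mapBasis m g = concatMap-map _ _

  extend₂-mapBasis : {A A′ B B′ C : Set} (m : B → B′ → Lin C) (g : A → B) (g′ : A′ → B′) (v : Lin A) (w : Lin A′) →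
                     extend₂ m (mapBasis g v) (mapBasis g′ w) ≡ extend₂ (λ a a′ → m (g a) (g′ a′)) v w
  extend₂-mapBasis m g g′ v w = trans (concatMap-map _ _ v) (concatMap-cong (λ _ → concatMap-map _ _ w) v)

  extend-cong : {A B : Set} {m m′ : A → Lin B} → (∀ a → m a ≡ m′ a) → ∀ (v : Lin A) → extend m v ≡ extend m′ v
  extend-cong m≗m′ = concatMap-cong (λ (x , a) → cong (scale x) (m≗m′ a))

  extend₂-cong : {A A′ B : Set} {m m′ : A → A′ → Lin B} → (∀ a a′ → m a a′ ≡ m′ a a′) →
                 ∀ (v : Lin A) (w : Lin A′) → extend₂ m v w ≡ extend₂ m′ v w
  extend₂-cong m≗m′ v w = concatMap-cong (λ (x , a) → concatMap-cong (λ (y , a′) → cong (scale (x *ᴷ y)) (m≗m′ a a′)) w) v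

  mapBasis-inverse : {A B : Set} (f : A → B) (g : B → A) → (∀ a → g (f a) ≡ a) → ∀ (v : Lin A) → mapBasis g (mapBasis f v) ≡ v
  mapBasis-inverse f g g∘f v = trans (sym (map-∘ v)) (map-id-local (All.universal (λ (x , a) → cong (x ,_) (g∘f a)) v))

  evalL-mapBasis : {A B : Set} (h : B → Carrier) (g : A → B) (v : Lin A) → evalL h (mapBasis g v) ≡ evalL (h ∘ g) v
  evalL-mapBasis h g []      = refl
  evalL-mapBasis h g (_ ∷ v) = cong (_ +ᴷ_) (evalL-mapBasis h g v)

  mapBasis-tensor : {A A′ B B′ : Set} (f : A → B) (g : A′ → B′) (v : Lin A) (w : Lin A′) →
                    mapBasis (map× f g) (tensor v w) ≡ tensor (mapBasis f v) (mapBasis g w)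
  mapBasis-tensor f g v w = trans (mapBasis-extend₂ (map× f g) pair v w) (sym (extend₂-mapBasis pair f g v w))
    where
    pair : ∀ {X Y : Set} → X → Y → Lin (X × Y)
    pair x y = (1# , (x , y)) ∷ []

  mapBasis-≋ : {A B : Set} (g : A → B) {v w : Lin A} → v ≋ w → mapBasis g v ≋ mapBasis g w
  mapBasis-≋ g []                 = []
  mapBasis-≋ g ((e , refl) ∷ rest) = (e , refl) ∷ mapBasis-≋ g rest

  evalL-≋ : {A : Set} (h : A → Carrier) {v w : Lin A} → v ≋ w → evalL h v ≈ evalL h w
  evalL-≋ h []                 = ≈-refl
  evalL-≋ h ((e , refl) ∷ rest) = +ᴷ-cong (*ᴷ-cong e ≈-refl) (evalL-≋ h rest)

  evalL-cong : {A : Set} {h h′ : A → Carrier} → (∀ a → h a ≡ h′ a) → ∀ (v : Lin A) → evalL h v ≡ evalL h′ v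
  evalL-cong h≗h′ []            = refl
  evalL-cong h≗h′ ((x , a) ∷ v) = cong₂ (λ y r → (x *ᴷ y) +ᴷ r) (h≗h′ a) (evalL-cong h≗h′ v)

  singleton : {A B : Set} → (A → B) → A → Lin B
  singleton f a = (1# , f a) ∷ []

  private
    extend-unit-coefficients : {A B : Set} (m : A → Lin B) (e : A → Carrier) (g : A → B) →
                               (∀ a → m a ≡ (e a , g a) ∷ []) → (∀ a → e a ≈ 1#) →
                               ∀ (v : Lin A) → extend m v ≋ mapBasis g v
    extend-unit-coefficients m e g m≡ e≈1 []            = []
    extend-unit-coefficients m e g m≡ e≈1 ((x , a) ∷ v) rewrite m≡ a =
      (≈-trans (*ᴷ-cong ≈-refl (e≈1 a)) (*ᴷ-identityʳ x) , refl) ∷ extend-unit-coefficients m e g m≡ e≈1 v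

  extend-singleton : {A B : Set} (f : A → B) (v : Lin A) → extend (singleton f) v ≋ mapBasis f v
  extend-singleton f = extend-unit-coefficients (singleton f) (λ _ → 1#) f (λ _ → refl) (λ _ → ≈-refl)

  extend⊗-singleton : {A A′ B B′ : Set} (f : A → B) (g : A′ → B′) (v : Lin (A × A′)) →
                      extend⊗ (singleton f) (singleton g) v ≋ mapBasis (map× f g) v
  extend⊗-singleton f g = extend-unit-coefficients _ (λ _ → (1# *ᴷ 1#) *ᴷ 1#) (map× f g) (λ _ → refl)
                                                   (λ _ → ≈-trans (*ᴷ-identityʳ _) (*ᴷ-identityʳ _))

  extend-singleton-inverse : {A B : Set} (f : A → B) (g : B → A) → (∀ a → g (f a) ≡ a) →
                             ∀ (v : Lin A) → extend (singleton g) (extend (singleton f) v) ≋ v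
  extend-singleton-inverse f g g∘f v = begin
    extend (singleton g) (extend (singleton f) v)   ≈⟨ extend-singleton g (extend (singleton f) v) ⟩
    mapBasis g (extend (singleton f) v)             ≈⟨ mapBasis-≋ g (extend-singleton f v) ⟩
    mapBasis g (mapBasis f v)                       ≡⟨ mapBasis-inverse f g g∘f v ⟩
    v                                               ∎
    where open SetoidReasoning (≋-setoid _)

  module _ (H H′ : BasedBialgebra) where
    private
      module H  = BasedBialgebra H
      module H′ = BasedBialgebra H′

    extend-singleton-unit : (f : H.Basis → H′.Basis) → f H.unitB ≡ H′.unitB → extend (singleton f) H.one ≋ H′.one
    extend-singleton-unit f f-unit = begin
      extend (singleton f) H.one   ≈⟨ extend-singleton f H.one ⟩
      (1# , f H.unitB) ∷ []        ≡⟨ cong (λ b → (1# , b) ∷ []) f-unit ⟩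
      H′.one                       ∎
      where open SetoidReasoning (≋-setoid H′.Basis)

    extend-singleton-mul : (f : H.Basis → H′.Basis) → (∀ x y → mapBasis f (H.mulB x y) ≡ H′.mulB (f x) (f y)) →
                           ∀ v w → extend (singleton f) (H.mul v w) ≋ H′.mul (extend (singleton f) v) (extend (singleton f) w)
    extend-singleton-mul f f-mul v w = begin
      extend (singleton f) (H.mul v w)                    ≈⟨ extend-singleton f (H.mul v w) ⟩
      mapBasis f (extend₂ H.mulB v w)                     ≡⟨ mapBasis-extend₂ f H.mulB v w ⟩
      extend₂ (λ x y → mapBasis f (H.mulB x y)) v w       ≡⟨ extend₂-cong f-mul v w ⟩
      extend₂ (λ x y → H′.mulB (f x) (f y)) v w           ≡⟨ extend₂-mapBasis H′.mulB f f v w ⟨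
      extend₂ H′.mulB (mapBasis f v) (mapBasis f w)       ≈⟨ extend₂-≋ H′.mulB (extend-singleton f v) (extend-singleton f w) ⟨
      extend₂ H′.mulB (extend (singleton f) v) (extend (singleton f) w) ∎
      where open SetoidReasoning (≋-setoid H′.Basis)

    extend⊗-singleton-comul : (f : H.Basis → H′.Basis) → (∀ x → mapBasis (map× f f) (H.comulB x) ≡ H′.comulB (f x)) →
                              ∀ v → extend⊗ (singleton f) (singleton f) (H.comul v) ≋ H′.comul (extend (singleton f) v)
    extend⊗-singleton-comul f f-comul v = begin
      extend⊗ (singleton f) (singleton f) (H.comul v)    ≈⟨ extend⊗-singleton f f (H.comul v) ⟩
      mapBasis (map× f f) (extend H.comulB v)            ≡⟨ mapBasis-extend (map× f f) H.comulB v ⟩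
      extend (mapBasis (map× f f) ∘ H.comulB) v          ≡⟨ extend-cong f-comul v ⟩
      extend (H′.comulB ∘ f) v                           ≡⟨ extend-mapBasis H′.comulB f v ⟨
      extend H′.comulB (mapBasis f v)                    ≈⟨ extend-≋ H′.comulB (extend-singleton f v) ⟨
      extend H′.comulB (extend (singleton f) v)          ∎
      where open SetoidReasoning (≋-setoid (H′.Basis × H′.Basis))

    extend-singleton-counit : (f : H.Basis → H′.Basis) → (∀ x → H′.counitB (f x) ≡ H.counitB x) →
                              ∀ v → H′.counit (extend (singleton f) v) ≈ H.counit v
    extend-singleton-counit f f-counit v = begin
      evalL H′.counitB (extend (singleton f) v)  ≈⟨ evalL-≋ H′.counitB (extend-singleton f v) ⟩
      evalL H′.counitB (mapBasis f v)            ≡⟨ evalL-mapBasis H′.counitB f v ⟩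
      evalL (H′.counitB ∘ f) v                   ≡⟨ evalL-cong f-counit v ⟩
      evalL H.counitB v                          ∎
      where open SetoidReasoning K-setoid

    basisBijection⇒BialgebraIso :
      (f : H.Basis → H′.Basis) (g : H′.Basis → H.Basis) → (∀ x → g (f x) ≡ x) → (∀ y → f (g y) ≡ y) →
      f H.unitB ≡ H′.unitB →
      (∀ x y → mapBasis f (H.mulB x y) ≡ H′.mulB (f x) (f y)) →
      (∀ x → mapBasis (map× f f) (H.comulB x) ≡ H′.comulB (f x)) →
      (∀ x → H′.counitB (f x) ≡ H.counitB x) →
      BialgebraIso H H′
    basisBijection⇒BialgebraIso f g g∘f f∘g f-unit f-mul f-comul f-counit = record
      { φ        = singleton f
      ; ψ        = singleton g
      ; ΨΦ       = ≋⇒Eq H._≟B_ ∘ extend-singleton-inverse f g g∘f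
      ; ΦΨ       = ≋⇒Eq H′._≟B_ ∘ extend-singleton-inverse g f f∘g
      ; Φ-unit   = ≋⇒Eq H′._≟B_ (extend-singleton-unit f f-unit)
      ; Φ-mul    = λ v w → ≋⇒Eq H′._≟B_ (extend-singleton-mul f f-mul v w)
      ; Φ-comul  = ≋⇒Eq _ ∘ extend⊗-singleton-comul f f-comul
      ; Φ-counit = extend-singleton-counit f f-counit
      }

-- The isomorphism

carve-≡ : ∀ {R : Set} {P : R → Bool} {r s : R} {p : T (P r)} {q : T (P s)} → r ≡ s → _≡_ {A = Carve P} (r , p) (s , q)
carve-≡ {p = p} {q} refl = cong (_ ,_) (T-irr p q)

toWordᴮ : ParkingFunction → ParkingWord
toWordᴮ (Φ , t) = toWord Φ , toWord-isParkingWord Φ t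

toPFᴮ : ParkingWord → ParkingFunction
toPFᴮ (a , t) = toPF a , toPF-isParkingFunction a t

toPFᴮ-toWordᴮ : ∀ x → toPFᴮ (toWordᴮ x) ≡ x
toPFᴮ-toWordᴮ (Φ , t) = carve-≡ (toPF-toWord Φ t)

toWordᴮ-toPFᴮ : ∀ a → toWordᴮ (toPFᴮ a) ≡ a
toWordᴮ-toPFᴮ (a , t) = carve-≡ (toWord-toPF a t)

module _ {c ℓ} (K : Field c ℓ) where
  open Field K using (1#)
  open FreeModule K
  private
    module KP = BasedBialgebra (KdualPF K)
    module PQ = BasedBialgebra (PQSym K)

  embed-accept : ∀ {R : Set} (P : R → Bool) r (p : T (P r)) → embed P r ≡ (1# , (r , p)) ∷ []
  embed-accept P r p with T? (P r)
  ... | yes p′ = cong (λ p″ → (1# , (r , p″)) ∷ []) (T-irr p′ p)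
  ... | no  ¬p = ⊥-elim (¬p p)

  mapBasis-embed-toPF : ∀ a → T (isParkingWord a) →
                        mapBasis K toWordᴮ (embed isParkingFunction (toPF a)) ≡ embed isParkingWord a
  mapBasis-embed-toPF a a-pw
    rewrite embed-accept isParkingFunction (toPF a) (toPF-isParkingFunction a a-pw) | embed-accept isParkingWord a a-pw =
    cong (λ w → (1# , w) ∷ []) (carve-≡ (toWord-toPF a a-pw))

  PQSym-mulB-masks : ∀ a b (a-pw : T (isParkingWord a)) (b-pw : T (isParkingWord b)) →
                     PQ.mulB (a , a-pw) (b , b-pw)
                     ≡ concatMap (λ σ → embed isParkingWord (merge σ a (map (length a +_) b))) (masks (length a) (length b))
  PQSym-mulB-masks a b _ _ = begin
    concatMap (embed isParkingWord) (shuffle a b′)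
      ≡⟨ cong (concatMap (embed isParkingWord)) (shuffle≡merges a b′) ⟩
    concatMap (embed isParkingWord) (map (λ σ → merge σ a b′) (masks (length a) (length b′)))
      ≡⟨ cong (λ t → concatMap (embed isParkingWord) (map (λ σ → merge σ a b′) (masks (length a) t))) (length-map _ b) ⟩
    concatMap (embed isParkingWord) (map (λ σ → merge σ a b′) (masks (length a) (length b)))
      ≡⟨ concatMap-map _ _ (masks (length a) (length b)) ⟩
    concatMap (λ σ → embed isParkingWord (merge σ a b′)) (masks (length a) (length b)) ∎
    where
    open ≡-Reasoning
    b′ = map (length a +_) b

  mulB-toPFᴮ : ∀ a b → mapBasis K toWordᴮ (KP.mulB (toPFᴮ a) (toPFᴮ b)) ≡ PQ.mulB a b
  mulB-toPFᴮ (a , a-pw) (b , b-pw) = begin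
    mapBasis K toWordᴮ (products (length (toPF a)) (length (toPF b)))
      ≡⟨ cong₂ (λ s t → mapBasis K toWordᴮ (products s t)) (length-toPF a) (length-toPF b) ⟩
    mapBasis K toWordᴮ (products s t)
      ≡⟨ cong (mapBasis K toWordᴮ) (trans (cong (concatMap _) (choose≡selections s t I ∣I∣)) (concatMap-map _ _ (masks s t))) ⟩
    mapBasis K toWordᴮ (concatMap (λ σ → embed isParkingFunction (shuffled σ)) (masks s t))
      ≡⟨ map-concatMap _ _ (masks s t) ⟩
    concatMap (λ σ → mapBasis K toWordᴮ (embed isParkingFunction (shuffled σ))) (masks s t)
      ≡⟨ concatMap-cong-local (All.map shuffled-toWord (masks-Mask s t)) ⟩
    concatMap (λ σ → embed isParkingWord (merge σ a b′)) (masks s t)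
      ≡⟨ PQSym-mulB-masks a b a-pw b-pw ⟨
    PQ.mulB (a , a-pw) (b , b-pw) ∎
    where
    open ≡-Reasoning
    s  = length a
    t  = length b
    b′ = map (s +_) b
    I  = interval (s + t)
    ∣I∣ : length I ≡ s + t
    ∣I∣ = trans (cong length (interval≡range (s + t))) (length-range 1 (s + t))
    products : ℕ → ℕ → Lin ParkingFunction
    products s′ t′ = concatMap (λ S → embed isParkingFunction (relabel S (toPF a) ++ relabel (complementIn (s′ + t′) S) (toPF b)))
                               (choose s′ (interval (s′ + t′)))
    shuffled : List Bool → List (List ℕ)
    shuffled σ = relabel (select σ I) (toPF a) ++ relabel (complementIn (s + t) (select σ I)) (toPF b)
    shuffled-toWord : ∀ {σ} → Mask σ s t →
                      mapBasis K toWordᴮ (embed isParkingFunction (shuffled σ)) ≡ embed isParkingWord (merge σ a b′)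
    shuffled-toWord {σ} mask = trans (cong (mapBasis K toWordᴮ ∘ embed isParkingFunction) (toPF-merge σ a b a-pw b-pw mask))
                                     (mapBasis-embed-toPF _ (merge-isParkingWord σ a b a-pw b-pw mask))

  comulB-toPFᴮ : ∀ a → mapBasis K (map× toWordᴮ toWordᴮ) (KP.comulB (toPFᴮ a)) ≡ PQ.comulB a
  comulB-toPFᴮ (a , a-pw) = begin
    mapBasis K (map× toWordᴮ toWordᴮ) (coproducts (length (toPF a)))
      ≡⟨ cong (mapBasis K (map× toWordᴮ toWordᴮ) ∘ coproducts) (length-toPF a) ⟩
    mapBasis K (map× toWordᴮ toWordᴮ) (coproducts (length a))
      ≡⟨ map-concatMap _ _ (upTo (suc (length a))) ⟩
    concatMap (λ i → mapBasis K (map× toWordᴮ toWordᴮ) (term i)) (upTo (suc (length a)))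
      ≡⟨ concatMap-cong deconcatenated (upTo (suc (length a))) ⟩
    concatMap (λ i → tensor (embed isParkingWord (Park (take i a))) (embed isParkingWord (Park (drop i a)))) (upTo (suc (length a)))
      ≡⟨ concatMap-map _ _ (upTo (suc (length a))) ⟨
    PQ.comulB (a , a-pw) ∎
    where
    open ≡-Reasoning
    term : ℕ → Lin (ParkingFunction × ParkingFunction)
    term i = tensor (embed isParkingFunction (park (restrictLow i (toPF a))))
                    (embed isParkingFunction (shiftDown i (park (restrictHigh i (toPF a)))))
    coproducts : ℕ → Lin (ParkingFunction × ParkingFunction)
    coproducts n = concatMap term (upTo (suc n))
    deconcatenated : ∀ i → mapBasis K (map× toWordᴮ toWordᴮ) (term i)
                           ≡ tensor (embed isParkingWord (Park (take i a))) (embed isParkingWord (Park (drop i a)))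
    deconcatenated i
      rewrite proj₁ (park-restrictLow-toPF a i a-pw) | proj₁ (park-restrictHigh-toPF a i a-pw) =
      trans (mapBasis-tensor K toWordᴮ toWordᴮ (embed isParkingFunction (toPF (Park (take i a))))
                                              (embed isParkingFunction (toPF (Park (drop i a)))))
            (cong₂ tensor (mapBasis-embed-toPF (Park (take i a)) (proj₂ (park-restrictLow-toPF a i a-pw)))
                          (mapBasis-embed-toPF (Park (drop i a)) (proj₂ (park-restrictHigh-toPF a i a-pw))))

  counitB-toWordᴮ : ∀ x → PQ.counitB (toWordᴮ x) ≡ KP.counitB x
  counitB-toWordᴮ ([]    , _) = refl
  counitB-toWordᴮ (_ ∷ _ , _) = refl

  mulB-toWordᴮ : ∀ x y → mapBasis K toWordᴮ (KP.mulB x y) ≡ PQ.mulB (toWordᴮ x) (toWordᴮ y)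
  mulB-toWordᴮ x y = subst₂ (λ x′ y′ → mapBasis K toWordᴮ (KP.mulB x′ y′) ≡ PQ.mulB (toWordᴮ x) (toWordᴮ y))
                            (toPFᴮ-toWordᴮ x) (toPFᴮ-toWordᴮ y) (mulB-toPFᴮ (toWordᴮ x) (toWordᴮ y))

  comulB-toWordᴮ : ∀ x → mapBasis K (map× toWordᴮ toWordᴮ) (KP.comulB x) ≡ PQ.comulB (toWordᴮ x)
  comulB-toWordᴮ x = subst (λ x′ → mapBasis K (map× toWordᴮ toWordᴮ) (KP.comulB x′) ≡ PQ.comulB (toWordᴮ x))
                           (toPFᴮ-toWordᴮ x) (comulB-toPFᴮ (toWordᴮ x))

-- The isomorphism maps basis to basis.
proposition4p9 : ∀ {c ℓ} (K : Field c ℓ) → CharZero K →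
    FreeModule.BialgebraIso K (KdualPF K) (PQSym K)
proposition4p9 K _ =
  basisBijection⇒BialgebraIso K (KdualPF K) (PQSym K) toWordᴮ toPFᴮ toPFᴮ-toWordᴮ toWordᴮ-toPFᴮ
    refl (mulB-toWordᴮ K) (comulB-toWordᴮ K) (counitB-toWordᴮ K)
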